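{- Let $d\ge2$ be an integer. For any nonzero $f(z)\in\mathbb{Z}[z]$ and any $k\in\mathbb{N}$ there exists a constant $c=c(f,k)$ such that for every $m\in\mathbb{N}$, $\sigma(\Phi_k(z),f(z^{d^m}))<c$.
   Context: $\Phi_k(z)$ denotes the $k$-th cyclotomic polynomial. For polynomials $g,h\in\mathbb{Z}[z]$ with $\deg g>0$, $\sigma(g,h)=\max\{n\in\mathbb{Z}_{\ge0}: g(z)^n\mid h(z)\}$. -}

module Defs where

open import Data.Nat as ℕ using (ℕ; zero; suc; _∸_; _<ᵇ_)
open import Data.Nat.Divisibility using (_∣?_)
open import Data.Integer as ℤ using (ℤ; 0ℤ; 1ℤ; -1ℤ)
open import Data.Integer.Properties using () renaming (_≟_ to _≟ℤ_)
open import Data.List using (List; []; _∷_; map; foldr; filter; upTo; replicate; _++_; length)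
open import Data.Bool using (if_then_else_)
open import Data.Product using (∃-syntax)
open import Relation.Nullary.Decidable using (⌊_⌋)
open import Relation.Binary.PropositionalEquality using (_≡_)

-- Polynomials in ℤ[z] as coefficient lists, lowest degree first.
-- Trailing zeros are allowed; equality is coefficientwise (_≈ₚ_).
Poly : Set
Poly = List ℤ

coeff : Poly → ℕ → ℤ
coeff []      _       = 0ℤ
coeff (a ∷ p) zero    = a
coeff (a ∷ p) (suc i) = coeff p i

infix 4 _≈ₚ_
_≈ₚ_ : Poly → Poly → Set
p ≈ₚ q = ∀ i → coeff p i ≡ coeff q i

infixl 6 _+ₚ_ _-ₚ_
infixl 7 _*ₚ_

_+ₚ_ : Poly → Poly → Poly
[]      +ₚ q       = q
(a ∷ p) +ₚ []      = a ∷ p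
(a ∷ p) +ₚ (b ∷ q) = (a ℤ.+ b) ∷ (p +ₚ q)

negₚ : Poly → Poly
negₚ = map (λ x → ℤ.- x)

_-ₚ_ : Poly → Poly → Poly
p -ₚ q = p +ₚ negₚ q

scale : ℤ → Poly → Poly
scale c = map (c ℤ.*_)

_*ₚ_ : Poly → Poly → Poly
[]      *ₚ q = []
(a ∷ p) *ₚ q = scale a q +ₚ (0ℤ ∷ (p *ₚ q))

oneₚ : Poly
oneₚ = 1ℤ ∷ []

shift : ℕ → Poly → Poly
shift e p = replicate e 0ℤ ++ p

X^ : ℕ → Poly
X^ n = shift n oneₚ

infixr 8 _^ₚ_
_^ₚ_ : Poly → ℕ → Poly
p ^ₚ zero  = oneₚ
p ^ₚ suc n = p *ₚ (p ^ₚ n)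

prodₚ : List Poly → Poly
prodₚ = foldr _*ₚ_ oneₚ

_∘ₚ_ : Poly → Poly → Poly
f ∘ₚ g = foldr (λ a acc → (a ∷ []) +ₚ (g *ₚ acc)) [] f

infix 4 _∣ₚ_
_∣ₚ_ : Poly → Poly → Set
g ∣ₚ h = ∃[ q ] (g *ₚ q ≈ₚ h)

strip : Poly → Poly
strip [] = []
strip (a ∷ p) with strip p
... | []    = if ⌊ a ≟ℤ 0ℤ ⌋ then [] else (a ∷ [])
... | r     = a ∷ r

lastCoeff : Poly → ℤ
lastCoeff []          = 0ℤ
lastCoeff (a ∷ [])    = a
lastCoeff (a ∷ b ∷ p) = lastCoeff (b ∷ p)

-- quotient of long division of p by g (intended for monic g), with fuel
divF : ℕ → Poly → Poly → Poly
divF zero    p g = []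
divF (suc n) p g =
  let p' = strip p
      g' = strip g
      lp = length p'
      lg = length g'
  in if lp <ᵇ lg then [] else
     (let t = shift (lp ∸ lg) (lastCoeff p' ∷ [])
      in t +ₚ divF n (p' -ₚ t *ₚ g') g')

-- proper divisors of k (divisors d with d < k); for k ≥ 1 these are ≥ 1
properDivisors : ℕ → List ℕ
properDivisors k = filter (_∣? k) (upTo k)

-- Cyclotomic polynomials via z^k - 1 = ∏_{d ∣ k} Φ_d, i.e.
-- Φ_k = (z^k - 1) / ∏_{d ∣ k, d < k} Φ_d   (exact division by a monic polynomial),
-- computed with a fuel argument.
cycF : ℕ → ℕ → Poly
cycF zero    k = oneₚ
cycF (suc f) k =
  let num = X^ k -ₚ oneₚ
  in divF (length num) num (prodₚ (map (cycF f) (properDivisors k)))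

-- Φ_k (meaningful for k ≥ 1)
Φ : ℕ → Poly
Φ k = cycF k k

-- "σ(g,h) < c": every n with g^n ∣ h satisfies n < c
-- (σ(g,h) = max{n : g^n ∣ h}, so this is σ(g,h) < c whenever the max exists)
σ<_ : ℕ → Poly → Poly → Set
(σ< c) g h = ∀ n → g ^ₚ n ∣ₚ h → n ℕ.< c

{-# OPTIONS --safe #-}
-- Let θ = z d/dz. If g^(n+1) divides h then g^n divides θh - s h for every integer s, and
-- θ(f(z^D)) = D (θf)(z^D). When f has no terms beyond z^L, θ - LD sends f(z^D) to D f'(z^D)
-- with f' = (θ - L) f, which has no terms beyond z^(L-1). So every factor Φ_k of f(z^D) can be
-- traded for a coefficient of f, until f is a monomial c z^j, which Φ_k cannot divide, being a
-- nonconstant divisor of z^k - 1. Hence σ(Φ_k, f(z^D)) < length f for every D ≥ 1 (so d ≥ 1 would do).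
--
-- That Φ_k, as defined by exact division, is monic of positive degree with
-- Φ_k ∏_{e ∣ k, e < k} Φ_e = z^k - 1 is shown by strong induction on k: the Φ_e are pairwise
-- coprime divisors of z^k - 1, as z^n - 1 is squarefree (θ - n maps it to the constant n), so
-- the long division leaves no remainder; and deg Φ_k = φ(k) ≥ 1 by Gauss's identity ∑_{e ∣ k} φ(e) = k.
module Submission where

open import Defs
open import Data.Nat using (ℕ; _≤_; _^_)
open import Data.Product using (∃-syntax)
open import Data.List using ([])
open import Relation.Nullary using (¬_)

module PolynomialRing where

  open import Data.Nat using (zero; suc)
  open import Data.Integer using (0ℤ; 1ℤ; _+_; _*_; -_)
  import Data.Integer.Properties as ℤP
  open import Data.Integer.Tactic.RingSolver using (solve-∀)
  open import Data.List using (_∷_)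
  open import Data.Maybe using (Maybe; just; nothing)
  open import Data.Product using (_,_)
  open import Relation.Binary.PropositionalEquality
  open import Relation.Nullary using (yes)
  open import Relation.Binary.Bundles using (Setoid)
  open import Relation.Binary.Structures using (IsEquivalence)
  open import Algebra.Bundles using (CommutativeRing)
  import Tactic.RingSolver.Core.AlmostCommutativeRing as ACR

  -- _≈ₚ_ wrapped in a record, so that both sides can be inferred from a proof.
  infix 4 _≋_
  record _≋_ (p q : Poly) : Set where
    constructor ⟦_⟧
    field at : p ≈ₚ q
  open _≋_ public

  ≋-refl : ∀ {p} → p ≋ p
  ≋-refl = ⟦ (λ i → refl) ⟧

  ≋-sym : ∀ {p q} → p ≋ q → q ≋ p
  ≋-sym e = ⟦ (λ i → sym (at e i)) ⟧

  ≋-trans : ∀ {p q r} → p ≋ q → q ≋ r → p ≋ r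
  ≋-trans e f = ⟦ (λ i → trans (at e i) (at f i)) ⟧

  ≋-isEquivalence : IsEquivalence _≋_
  ≋-isEquivalence = record { refl = ≋-refl ; sym = ≋-sym ; trans = ≋-trans }

  ≋-setoid : Setoid _ _
  ≋-setoid = record { isEquivalence = ≋-isEquivalence }

  ∷-cong : ∀ {a b p q} → a ≡ b → p ≋ q → a ∷ p ≋ b ∷ q
  ∷-cong e f = ⟦ (λ { zero → e ; (suc i) → at f i }) ⟧

  ∷-tail : ∀ {a b p q} → a ∷ p ≋ b ∷ q → p ≋ q
  ∷-tail e = ⟦ (λ i → at e (suc i)) ⟧

  coeff-+ : ∀ p q i → coeff (p +ₚ q) i ≡ coeff p i + coeff q i
  coeff-+ []      q       i       = sym (ℤP.+-identityˡ (coeff q i))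
  coeff-+ (a ∷ p) []      i       = sym (ℤP.+-identityʳ (coeff (a ∷ p) i))
  coeff-+ (a ∷ p) (b ∷ q) zero    = refl
  coeff-+ (a ∷ p) (b ∷ q) (suc i) = coeff-+ p q i

  coeff-scale : ∀ c p i → coeff (scale c p) i ≡ c * coeff p i
  coeff-scale c []      i       = sym (ℤP.*-zeroʳ c)
  coeff-scale c (a ∷ p) zero    = refl
  coeff-scale c (a ∷ p) (suc i) = coeff-scale c p i

  coeff-neg : ∀ p i → coeff (negₚ p) i ≡ - coeff p i
  coeff-neg []      i       = refl
  coeff-neg (a ∷ p) zero    = refl
  coeff-neg (a ∷ p) (suc i) = coeff-neg p i

  coeff-sub : ∀ p q i → coeff (p -ₚ q) i ≡ coeff p i + - coeff q i
  coeff-sub p q i = trans (coeff-+ p (negₚ q) i) (cong (coeff p i +_) (coeff-neg q i))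

  coeff-∷* : ∀ a p q i → coeff ((a ∷ p) *ₚ q) i ≡ a * coeff q i + coeff (0ℤ ∷ (p *ₚ q)) i
  coeff-∷* a p q i =
    trans (coeff-+ (scale a q) (0ℤ ∷ (p *ₚ q)) i) (cong (_+ coeff (0ℤ ∷ (p *ₚ q)) i) (coeff-scale a q i))

  +-cong : ∀ {p p' q q'} → p ≋ p' → q ≋ q' → p +ₚ q ≋ p' +ₚ q'
  +-cong {p} {p'} {q} {q'} e f =
    ⟦ (λ i → trans (coeff-+ p q i) (trans (cong₂ _+_ (at e i) (at f i)) (sym (coeff-+ p' q' i)))) ⟧

  neg-cong : ∀ {p q} → p ≋ q → negₚ p ≋ negₚ q
  neg-cong {p} {q} e =
    ⟦ (λ i → trans (coeff-neg p i) (trans (cong -_ (at e i)) (sym (coeff-neg q i)))) ⟧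

  +-identityʳ : ∀ p → p +ₚ [] ≋ p
  +-identityʳ p = ⟦ (λ i → trans (coeff-+ p [] i) (ℤP.+-identityʳ _)) ⟧

  +-comm : ∀ p q → p +ₚ q ≋ q +ₚ p
  +-comm p q = ⟦ (λ i → trans (coeff-+ p q i)
    (trans (ℤP.+-comm (coeff p i) (coeff q i)) (sym (coeff-+ q p i)))) ⟧

  +-assoc : ∀ p q r → (p +ₚ q) +ₚ r ≋ p +ₚ (q +ₚ r)
  +-assoc p q r = ⟦ (λ i → begin
    coeff ((p +ₚ q) +ₚ r) i                ≡⟨ coeff-+ (p +ₚ q) r i ⟩
    coeff (p +ₚ q) i + coeff r i           ≡⟨ cong (_+ coeff r i) (coeff-+ p q i) ⟩
    coeff p i + coeff q i + coeff r i      ≡⟨ ℤP.+-assoc (coeff p i) (coeff q i) (coeff r i) ⟩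
    coeff p i + (coeff q i + coeff r i)    ≡⟨ cong (coeff p i +_) (coeff-+ q r i) ⟨
    coeff p i + coeff (q +ₚ r) i           ≡⟨ coeff-+ p (q +ₚ r) i ⟨
    coeff (p +ₚ (q +ₚ r)) i                ∎) ⟧
    where open ≡-Reasoning

  +-inverseˡ : ∀ p → negₚ p +ₚ p ≋ []
  +-inverseˡ p = ⟦ (λ i → trans (coeff-+ (negₚ p) p i)
    (trans (cong (_+ coeff p i) (coeff-neg p i)) (ℤP.+-inverseˡ (coeff p i)))) ⟧

  +-inverseʳ : ∀ p → p +ₚ negₚ p ≋ []
  +-inverseʳ p = ≋-trans (+-comm p (negₚ p)) (+-inverseˡ p)

  scale-+ : ∀ a b r → scale (a + b) r ≋ scale a r +ₚ scale b r
  scale-+ a b r = ⟦ (λ i → trans (coeff-scale (a + b) r i) (trans (ℤP.*-distribʳ-+ (coeff r i) a b)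
    (sym (trans (coeff-+ (scale a r) (scale b r) i) (cong₂ _+_ (coeff-scale a r i) (coeff-scale b r i)))))) ⟧

  scale-distrib-+ : ∀ a p q → scale a (p +ₚ q) ≋ scale a p +ₚ scale a q
  scale-distrib-+ a p q = ⟦ (λ i → trans (coeff-scale a (p +ₚ q) i)
    (trans (cong (a *_) (coeff-+ p q i)) (trans (ℤP.*-distribˡ-+ a (coeff p i) (coeff q i))
    (sym (trans (coeff-+ (scale a p) (scale a q) i) (cong₂ _+_ (coeff-scale a p i) (coeff-scale a q i))))))) ⟧

  +-interchange : ∀ a b c d → (a +ₚ b) +ₚ (c +ₚ d) ≋ (a +ₚ c) +ₚ (b +ₚ d)
  +-interchange a b c d = ⟦ (λ i →
    trans (coeff-+ (a +ₚ b) (c +ₚ d) i) (trans (cong₂ _+_ (coeff-+ a b i) (coeff-+ c d i))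
    (trans (swap (coeff a i) (coeff b i) (coeff c i) (coeff d i))
    (sym (trans (coeff-+ (a +ₚ c) (b +ₚ d) i) (cong₂ _+_ (coeff-+ a c i) (coeff-+ b d i))))))) ⟧
    where
    swap : ∀ x y z w → (x + y) + (z + w) ≡ (x + z) + (y + w)
    swap = solve-∀

  *-zeroˡ-≋ : ∀ p q → p ≋ [] → p *ₚ q ≋ []
  *-zeroˡ-≋ []      q e = ≋-refl
  *-zeroˡ-≋ (a ∷ p) q e = ⟦ (λ i → trans (coeff-∷* a p q i) (vanish i)) ⟧
    where
    a≡0 : a ≡ 0ℤ
    a≡0 = at e zero
    pq≋0 : p *ₚ q ≋ []
    pq≋0 = *-zeroˡ-≋ p q ⟦ (λ i → at e (suc i)) ⟧
    vanish : ∀ i → a * coeff q i + coeff (0ℤ ∷ (p *ₚ q)) i ≡ 0ℤ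
    vanish zero    rewrite a≡0 = refl
    vanish (suc i) rewrite a≡0 | at pq≋0 i = refl

  *-zeroʳ : ∀ p → p *ₚ [] ≋ []
  *-zeroʳ []      = ≋-refl
  *-zeroʳ (a ∷ p) = ⟦ (λ { zero → refl ; (suc i) → at (*-zeroʳ p) i }) ⟧

  *-congʳ : ∀ {p p'} q → p ≋ p' → p *ₚ q ≋ p' *ₚ q
  *-congʳ {[]}    {p'}     q e = ≋-sym (*-zeroˡ-≋ p' q (≋-sym e))
  *-congʳ {a ∷ p} {[]}     q e = *-zeroˡ-≋ (a ∷ p) q e
  *-congʳ {a ∷ p} {b ∷ p'} q e rewrite at e zero =
    +-cong (≋-refl {scale b q}) (∷-cong refl (*-congʳ q (∷-tail e)))

  *-identityˡ : ∀ p → oneₚ *ₚ p ≋ p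
  *-identityˡ p = ⟦ (λ i → trans (coeff-∷* 1ℤ [] p i) (one i)) ⟧
    where
    one : ∀ i → 1ℤ * coeff p i + coeff (0ℤ ∷ []) i ≡ coeff p i
    one zero    = trans (ℤP.+-identityʳ _) (ℤP.*-identityˡ _)
    one (suc i) = trans (ℤP.+-identityʳ _) (ℤP.*-identityˡ _)

  *-∷ʳ : ∀ p b q → p *ₚ (b ∷ q) ≋ scale b p +ₚ (0ℤ ∷ (p *ₚ q))
  *-∷ʳ []      b q = ⟦ (λ { zero → refl ; (suc i) → refl }) ⟧
  *-∷ʳ (a ∷ p) b q = ⟦ (λ
    { zero    → trans (coeff-∷* a p (b ∷ q) zero) (trans (cong (_+ 0ℤ) (ℤP.*-comm a b))
                  (sym (coeff-+ (scale b (a ∷ p)) (0ℤ ∷ ((a ∷ p) *ₚ q)) zero)))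
    ; (suc i) → begin
        coeff ((a ∷ p) *ₚ (b ∷ q)) (suc i)
          ≡⟨ coeff-∷* a p (b ∷ q) (suc i) ⟩
        a * coeff q i + coeff (p *ₚ (b ∷ q)) i
          ≡⟨ cong (a * coeff q i +_) (trans (at (*-∷ʳ p b q) i) (coeff-+ (scale b p) (0ℤ ∷ (p *ₚ q)) i)) ⟩
        a * coeff q i + (coeff (scale b p) i + coeff (0ℤ ∷ (p *ₚ q)) i)
          ≡⟨ cong (λ x → a * coeff q i + (x + coeff (0ℤ ∷ (p *ₚ q)) i)) (coeff-scale b p i) ⟩
        a * coeff q i + (b * coeff p i + coeff (0ℤ ∷ (p *ₚ q)) i)
          ≡⟨ left-comm (a * coeff q i) (b * coeff p i) (coeff (0ℤ ∷ (p *ₚ q)) i) ⟩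
        b * coeff p i + (a * coeff q i + coeff (0ℤ ∷ (p *ₚ q)) i)
          ≡⟨ cong₂ _+_ (coeff-scale b p i) (coeff-∷* a p q i) ⟨
        coeff (scale b p) i + coeff ((a ∷ p) *ₚ q) i
          ≡⟨ coeff-+ (scale b (a ∷ p)) (0ℤ ∷ ((a ∷ p) *ₚ q)) (suc i) ⟨
        coeff (scale b (a ∷ p) +ₚ (0ℤ ∷ ((a ∷ p) *ₚ q))) (suc i) ∎ }) ⟧
    where
    open ≡-Reasoning
    left-comm : ∀ x y z → x + (y + z) ≡ y + (x + z)
    left-comm = solve-∀

  *-comm : ∀ p q → p *ₚ q ≋ q *ₚ p
  *-comm []      q = ≋-sym (*-zeroʳ q)
  *-comm (a ∷ p) q = ≋-trans (+-cong (≋-refl {scale a q}) (∷-cong refl (*-comm p q))) (≋-sym (*-∷ʳ q a p))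

  *-congˡ : ∀ p {q q'} → q ≋ q' → p *ₚ q ≋ p *ₚ q'
  *-congˡ p {q} {q'} e = ≋-trans (*-comm p q) (≋-trans (*-congʳ p e) (*-comm q' p))

  *-cong : ∀ {p p' q q'} → p ≋ p' → q ≋ q' → p *ₚ q ≋ p' *ₚ q'
  *-cong {p} {p'} {q} e f = ≋-trans (*-congʳ q e) (*-congˡ p' f)

  *-distribʳ : ∀ p q r → (p +ₚ q) *ₚ r ≋ p *ₚ r +ₚ q *ₚ r
  *-distribʳ []      q       r = ≋-refl
  *-distribʳ (a ∷ p) []      r = ≋-sym (+-identityʳ ((a ∷ p) *ₚ r))
  *-distribʳ (a ∷ p) (b ∷ q) r =
    ≋-trans (+-cong (scale-+ a b r) (∷-cong refl (*-distribʳ p q r)))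
            (+-interchange (scale a r) (scale b r) (0ℤ ∷ (p *ₚ r)) (0ℤ ∷ (q *ₚ r)))

  scale-* : ∀ a q r → scale a q *ₚ r ≋ scale a (q *ₚ r)
  scale-* a []      r = ≋-refl
  scale-* a (b ∷ q) r = ≋-trans
    (+-cong scale-scale (∷-cong (sym (ℤP.*-zeroʳ a)) (scale-* a q r)))
    (≋-sym (scale-distrib-+ a (scale b r) (0ℤ ∷ (q *ₚ r))))
    where
    scale-scale : scale (a * b) r ≋ scale a (scale b r)
    scale-scale = ⟦ (λ i → trans (coeff-scale (a * b) r i) (trans (ℤP.*-assoc a b (coeff r i))
      (sym (trans (coeff-scale a (scale b r) i) (cong (a *_) (coeff-scale b r i)))))) ⟧

  0∷-* : ∀ p r → (0ℤ ∷ p) *ₚ r ≋ 0ℤ ∷ (p *ₚ r)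
  0∷-* p r = ⟦ (λ i → trans (coeff-∷* 0ℤ p r i) (ℤP.+-identityˡ _)) ⟧

  *-assoc : ∀ p q r → (p *ₚ q) *ₚ r ≋ p *ₚ (q *ₚ r)
  *-assoc []      q r = ≋-refl
  *-assoc (a ∷ p) q r =
    ≋-trans (*-distribʳ (scale a q) (0ℤ ∷ (p *ₚ q)) r)
            (+-cong (scale-* a q r) (≋-trans (0∷-* (p *ₚ q) r) (∷-cong refl (*-assoc p q r))))

  *-identityʳ : ∀ p → p *ₚ oneₚ ≋ p
  *-identityʳ p = ≋-trans (*-comm p oneₚ) (*-identityˡ p)

  *-distribˡ : ∀ p q r → p *ₚ (q +ₚ r) ≋ p *ₚ q +ₚ p *ₚ r
  *-distribˡ p q r =
    ≋-trans (*-comm p (q +ₚ r)) (≋-trans (*-distribʳ q r p) (+-cong (*-comm q p) (*-comm r p)))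

  ℤ[z] : CommutativeRing _ _
  ℤ[z] = record
    { Carrier = Poly ; _≈_ = _≋_ ; _+_ = _+ₚ_ ; _*_ = _*ₚ_ ; -_ = negₚ ; 0# = [] ; 1# = oneₚ
    ; isCommutativeRing = record
      { isRing = record
        { +-isAbelianGroup = record
          { isGroup = record
            { isMonoid = record
              { isSemigroup = record
                { isMagma = record { isEquivalence = ≋-isEquivalence ; ∙-cong = +-cong }
                ; assoc = +-assoc }
              ; identity = (λ p → ≋-refl) , +-identityʳ }
            ; inverse = +-inverseˡ , +-inverseʳ
            ; ⁻¹-cong = neg-cong }
          ; comm = +-comm }
        ; *-cong = *-cong
        ; *-assoc = *-assoc
        ; *-identity = *-identityˡ , *-identityʳ
        ; distrib = *-distribˡ , (λ r p q → *-distribʳ p q r) }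
      ; *-comm = *-comm } }

  -- Recognises the zero polynomial, so that the ring solver can be used on ℤ[z].
  isZero? : (p : Poly) → Maybe ([] ≋ p)
  isZero? []      = just ≋-refl
  isZero? (a ∷ p) with a ℤP.≟ 0ℤ | isZero? p
  ... | yes a≡0 | just p≋0 = just ⟦ (λ { zero → sym a≡0 ; (suc i) → at p≋0 i }) ⟧
  ... | _       | _        = nothing

  ℤ[z]-almost : ACR.AlmostCommutativeRing _ _
  ℤ[z]-almost = ACR.fromCommutativeRing ℤ[z] isZero?


module EulerOperator where

  open PolynomialRing
  open import Data.Nat as ℕ using (zero; suc)
  import Data.Nat.Properties as ℕP
  open import Data.Integer as ℤ using (ℤ; 0ℤ; 1ℤ; _+_; _*_; -_)
  import Data.Integer.Properties as ℤP
  import Data.Integer.Tactic.RingSolver as ℤ-Solver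
  open import Tactic.RingSolver using (solve-∀)
  open import Data.List using (_∷_)
  open import Relation.Binary.PropositionalEquality using (_≡_; refl; sym; trans; cong; cong₂)
  open import Relation.Binary.Reasoning.Setoid ≋-setoid

  const : ℤ → Poly
  const a = a ∷ []

  const-cong : ∀ {a b} → a ≡ b → const a ≋ const b
  const-cong refl = ≋-refl

  const-0 : const 0ℤ ≋ []
  const-0 = ⟦ (λ { zero → refl ; (suc i) → refl }) ⟧

  const-+ : ∀ a b → const (a + b) ≋ const a +ₚ const b
  const-+ a b = ≋-refl

  const-* : ∀ a b → const (a * b) ≋ const a *ₚ const b
  const-* a b = ⟦ (λ { zero → sym (ℤP.+-identityʳ (a * b)) ; (suc i) → refl }) ⟧

  const-*ₚ : ∀ a p → const a *ₚ p ≋ scale a p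
  const-*ₚ a p = ⟦ (λ i → trans (coeff-+ (scale a p) (0ℤ ∷ []) i)
    (trans (cong (coeff (scale a p) i +_) (zero-tail i)) (ℤP.+-identityʳ _))) ⟧
    where
    zero-tail : ∀ i → coeff (0ℤ ∷ []) i ≡ 0ℤ
    zero-tail zero    = refl
    zero-tail (suc i) = refl

  coeff-const-*ₚ : ∀ a r i → coeff (const a *ₚ r) i ≡ a * coeff r i
  coeff-const-*ₚ a r i = trans (at (const-*ₚ a r) i) (coeff-scale a r i)

  X^1-*ₚ : ∀ h → X^ 1 *ₚ h ≋ 0ℤ ∷ h
  X^1-*ₚ h = ≋-trans (0∷-* (1ℤ ∷ []) h) (∷-cong refl (*-identityˡ h))

  ∷-split : ∀ a p → a ∷ p ≋ const a +ₚ X^ 1 *ₚ p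
  ∷-split a p = ≋-sym (≋-trans (+-cong (≋-refl {const a}) (X^1-*ₚ p))
    ⟦ (λ { zero → ℤP.+-identityʳ a ; (suc i) → refl }) ⟧)

  X^-suc : ∀ n → X^ (suc n) ≋ X^ 1 *ₚ X^ n
  X^-suc n = ≋-sym (X^1-*ₚ (X^ n))

  X^-+ : ∀ a b → X^ (a ℕ.+ b) ≋ X^ a *ₚ X^ b
  X^-+ zero    b = ≋-sym (*-identityˡ (X^ b))
  X^-+ (suc a) b = begin
    X^ (suc (a ℕ.+ b))     ≈⟨ X^-suc (a ℕ.+ b) ⟩
    X^ 1 *ₚ X^ (a ℕ.+ b)    ≈⟨ *-congˡ (X^ 1) (X^-+ a b) ⟩
    X^ 1 *ₚ (X^ a *ₚ X^ b)  ≈⟨ *-assoc (X^ 1) (X^ a) (X^ b) ⟨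
    X^ 1 *ₚ X^ a *ₚ X^ b    ≈⟨ *-congʳ (X^ b) (X^-suc a) ⟨
    X^ (suc a) *ₚ X^ b      ∎

  θ-from : ℕ → Poly → Poly
  θ-from k []      = []
  θ-from k (a ∷ p) = (ℤ.+ k * a) ∷ θ-from (suc k) p

  θ : Poly → Poly
  θ = θ-from 0

  coeff-θ : ∀ p i → coeff (θ p) i ≡ ℤ.+ i * coeff p i
  coeff-θ = coeff-θ-from 0
    where
    coeff-θ-from : ∀ k p i → coeff (θ-from k p) i ≡ ℤ.+ (k ℕ.+ i) * coeff p i
    coeff-θ-from k []      i       = sym (ℤP.*-zeroʳ (ℤ.+ (k ℕ.+ i)))
    coeff-θ-from k (a ∷ p) zero    = cong (λ n → ℤ.+ n * a) (sym (ℕP.+-identityʳ k))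
    coeff-θ-from k (a ∷ p) (suc i) =
      trans (coeff-θ-from (suc k) p i) (cong (λ n → ℤ.+ n * coeff p i) (sym (ℕP.+-suc k i)))

  θ-cong : ∀ {p q} → p ≋ q → θ p ≋ θ q
  θ-cong {p} {q} e = ⟦ (λ i → trans (coeff-θ p i) (trans (cong (ℤ.+ i *_) (at e i)) (sym (coeff-θ q i)))) ⟧

  θ-+ : ∀ p q → θ (p +ₚ q) ≋ θ p +ₚ θ q
  θ-+ p q = ⟦ (λ i → trans (coeff-θ (p +ₚ q) i) (trans (cong (ℤ.+ i *_) (coeff-+ p q i))
    (trans (ℤP.*-distribˡ-+ (ℤ.+ i) (coeff p i) (coeff q i))
    (sym (trans (coeff-+ (θ p) (θ q) i) (cong₂ _+_ (coeff-θ p i) (coeff-θ q i))))))) ⟧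

  θ-neg : ∀ p → θ (negₚ p) ≋ negₚ (θ p)
  θ-neg p = ⟦ (λ i → trans (coeff-θ (negₚ p) i) (trans (cong (ℤ.+ i *_) (coeff-neg p i))
    (trans (sym (ℤP.neg-distribʳ-* (ℤ.+ i) (coeff p i))) (sym (trans (coeff-neg (θ p) i) (cong -_ (coeff-θ p i))))))) ⟧

  θ-sub : ∀ p q → θ (p -ₚ q) ≋ θ p -ₚ θ q
  θ-sub p q = ≋-trans (θ-+ p (negₚ q)) (+-cong (≋-refl {θ p}) (θ-neg q))

  θ-const : ∀ a → θ (const a) ≋ []
  θ-const a = ⟦ (λ { zero → refl ; (suc i) → refl }) ⟧

  θ-const-*ₚ : ∀ a q → θ (const a *ₚ q) ≋ const a *ₚ θ q
  θ-const-*ₚ a q = ≋-trans (θ-cong (const-*ₚ a q)) (≋-trans θ-scale (≋-sym (const-*ₚ a (θ q))))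
    where
    left-comm : ∀ x y z → x * (y * z) ≡ y * (x * z)
    left-comm = ℤ-Solver.solve-∀
    θ-scale : θ (scale a q) ≋ scale a (θ q)
    θ-scale = ⟦ (λ i → trans (coeff-θ (scale a q) i) (trans (cong (ℤ.+ i *_) (coeff-scale a q i))
      (trans (left-comm (ℤ.+ i) a (coeff q i)) (sym (trans (coeff-scale a (θ q) i) (cong (a *_) (coeff-θ q i))))))) ⟧

  θ-X^1-*ₚ : ∀ h → θ (X^ 1 *ₚ h) ≋ X^ 1 *ₚ (h +ₚ θ h)
  θ-X^1-*ₚ h = ≋-trans (θ-cong (X^1-*ₚ h)) (≋-trans θ-0∷ (≋-sym (X^1-*ₚ (h +ₚ θ h))))
    where
    suc-* : ∀ i x → ℤ.+ (suc i) * x ≡ x + ℤ.+ i * x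
    suc-* i x = trans (cong (_* x) (ℤP.pos-+ 1 i))
      (trans (ℤP.*-distribʳ-+ x 1ℤ (ℤ.+ i)) (cong (_+ ℤ.+ i * x) (ℤP.*-identityˡ x)))
    θ-0∷ : θ (0ℤ ∷ h) ≋ 0ℤ ∷ (h +ₚ θ h)
    θ-0∷ = ⟦ (λ { zero → refl ; (suc i) → trans (coeff-θ (0ℤ ∷ h) (suc i)) (trans (suc-* i (coeff h i))
      (sym (trans (coeff-+ h (θ h) i) (cong (coeff h i +_) (coeff-θ h i))))) }) ⟧

  θ-∷ : ∀ a p → θ (a ∷ p) ≋ X^ 1 *ₚ (p +ₚ θ p)
  θ-∷ a p = begin
    θ (a ∷ p)                      ≈⟨ θ-cong (∷-split a p) ⟩
    θ (const a +ₚ X^ 1 *ₚ p)        ≈⟨ θ-+ (const a) (X^ 1 *ₚ p) ⟩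
    θ (const a) +ₚ θ (X^ 1 *ₚ p)    ≈⟨ +-cong (θ-const a) (θ-X^1-*ₚ p) ⟩
    [] +ₚ X^ 1 *ₚ (p +ₚ θ p)        ∎

  θ-* : ∀ p q → θ (p *ₚ q) ≋ θ p *ₚ q +ₚ p *ₚ θ q
  θ-* []      q = ≋-refl
  θ-* (a ∷ p) q = begin
    θ ((a ∷ p) *ₚ q)
      ≈⟨ θ-cong (≋-trans (*-congʳ q (∷-split a p)) (expand (const a) (X^ 1) p q)) ⟩
    θ (const a *ₚ q +ₚ X^ 1 *ₚ (p *ₚ q))
      ≈⟨ θ-+ (const a *ₚ q) (X^ 1 *ₚ (p *ₚ q)) ⟩
    θ (const a *ₚ q) +ₚ θ (X^ 1 *ₚ (p *ₚ q))
      ≈⟨ +-cong (θ-const-*ₚ a q) (θ-X^1-*ₚ (p *ₚ q)) ⟩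
    const a *ₚ θ q +ₚ X^ 1 *ₚ (p *ₚ q +ₚ θ (p *ₚ q))
      ≈⟨ +-cong (≋-refl {const a *ₚ θ q}) (*-congˡ (X^ 1) (+-cong (≋-refl {p *ₚ q}) (θ-* p q))) ⟩
    const a *ₚ θ q +ₚ X^ 1 *ₚ (p *ₚ q +ₚ (θ p *ₚ q +ₚ p *ₚ θ q))
      ≈⟨ regroup (const a) (X^ 1) p q (θ p) (θ q) ⟩
    X^ 1 *ₚ (p +ₚ θ p) *ₚ q +ₚ (const a +ₚ X^ 1 *ₚ p) *ₚ θ q
      ≈⟨ +-cong (*-congʳ q (θ-∷ a p)) (*-congʳ (θ q) (∷-split a p)) ⟨
    θ (a ∷ p) *ₚ q +ₚ (a ∷ p) *ₚ θ q ∎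
    where
    expand : ∀ A X P Q → (A +ₚ X *ₚ P) *ₚ Q ≋ A *ₚ Q +ₚ X *ₚ (P *ₚ Q)
    expand = solve-∀ ℤ[z]-almost
    regroup : ∀ A X P Q TP TQ →
      A *ₚ TQ +ₚ X *ₚ (P *ₚ Q +ₚ (TP *ₚ Q +ₚ P *ₚ TQ)) ≋ X *ₚ (P +ₚ TP) *ₚ Q +ₚ (A +ₚ X *ₚ P) *ₚ TQ
    regroup = solve-∀ ℤ[z]-almost

  θ-^-suc : ∀ g n → θ (g ^ₚ suc n) ≋ const (ℤ.+ suc n) *ₚ g ^ₚ n *ₚ θ g
  θ-^-suc g zero = begin
    θ (g *ₚ oneₚ)                      ≈⟨ θ-cong (*-identityʳ g) ⟩
    θ g                                ≈⟨ *-identityˡ (θ g) ⟨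
    oneₚ *ₚ θ g                        ≈⟨ *-congʳ (θ g) (*-identityʳ oneₚ) ⟨
    const (ℤ.+ 1) *ₚ oneₚ *ₚ θ g        ∎
  θ-^-suc g (suc n) = begin
    θ (g *ₚ g ^ₚ suc n)
      ≈⟨ θ-* g (g ^ₚ suc n) ⟩
    θ g *ₚ g ^ₚ suc n +ₚ g *ₚ θ (g ^ₚ suc n)
      ≈⟨ +-cong (≋-refl {θ g *ₚ g ^ₚ suc n}) (*-congˡ g (θ-^-suc g n)) ⟩
    θ g *ₚ (g *ₚ g ^ₚ n) +ₚ g *ₚ (const (ℤ.+ suc n) *ₚ g ^ₚ n *ₚ θ g)
      ≈⟨ collect (θ g) g (g ^ₚ n) (const (ℤ.+ suc n)) ⟩
    (oneₚ +ₚ const (ℤ.+ suc n)) *ₚ (g *ₚ g ^ₚ n) *ₚ θ g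
      ≈⟨ *-congʳ (θ g) (*-congʳ (g *ₚ g ^ₚ n) (const-cong (sym (ℤP.pos-+ 1 (suc n))))) ⟩
    const (ℤ.+ suc (suc n)) *ₚ (g *ₚ g ^ₚ n) *ₚ θ g ∎
    where
    collect : ∀ T G P A → T *ₚ (G *ₚ P) +ₚ G *ₚ (A *ₚ P *ₚ T) ≋ (oneₚ +ₚ A) *ₚ (G *ₚ P) *ₚ T
    collect = solve-∀ ℤ[z]-almost

  θ-X^ : ∀ n → θ (X^ n) ≋ const (ℤ.+ n) *ₚ X^ n
  θ-X^ zero    = ≋-trans (θ-const 1ℤ) (≋-sym (≋-trans (const-*ₚ 0ℤ oneₚ) const-0))
  θ-X^ (suc n) = begin
    θ (X^ (suc n))                                  ≈⟨ θ-cong (X^-suc n) ⟩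
    θ (X^ 1 *ₚ X^ n)                                 ≈⟨ θ-X^1-*ₚ (X^ n) ⟩
    X^ 1 *ₚ (X^ n +ₚ θ (X^ n))                       ≈⟨ *-congˡ (X^ 1) (+-cong (≋-refl {X^ n}) (θ-X^ n)) ⟩
    X^ 1 *ₚ (X^ n +ₚ const (ℤ.+ n) *ₚ X^ n)           ≈⟨ collect (X^ 1) (const (ℤ.+ n)) (X^ n) ⟩
    (oneₚ +ₚ const (ℤ.+ n)) *ₚ (X^ 1 *ₚ X^ n)         ≈⟨ *-cong (const-cong (sym (ℤP.pos-+ 1 n))) (X^-suc n) ⟨
    const (ℤ.+ suc n) *ₚ X^ (suc n)                  ∎
    where
    collect : ∀ X K H → X *ₚ (H +ₚ K *ₚ H) ≋ (oneₚ +ₚ K) *ₚ (X *ₚ H)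
    collect = solve-∀ ℤ[z]-almost

  θ⟨_⟩ : ℤ → Poly → Poly
  θ⟨ s ⟩ f = θ f -ₚ const s *ₚ f

  θ⟨⟩-cong : ∀ s {p q} → p ≋ q → θ⟨ s ⟩ p ≋ θ⟨ s ⟩ q
  θ⟨⟩-cong s e = +-cong (θ-cong e) (neg-cong (*-congˡ (const s) e))

  coeff-θ⟨⟩ : ∀ s f i → coeff (θ⟨ s ⟩ f) i ≡ (ℤ.+ i + - s) * coeff f i
  coeff-θ⟨⟩ s f i = trans (coeff-sub (θ f) (const s *ₚ f) i)
    (trans (cong₂ (λ x y → x + - y) (coeff-θ f i) (coeff-const-*ₚ s f i)) (factor (ℤ.+ i) s (coeff f i)))
    where
    factor : ∀ a b x → a * x + - (b * x) ≡ (a + - b) * x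
    factor = ℤ-Solver.solve-∀


module Divisibility where

  open PolynomialRing
  open EulerOperator
  open import Data.Nat as ℕ using (zero; suc)
  open import Data.Integer as ℤ using (ℤ)
  open import Data.Product using (_,_)
  open import Tactic.RingSolver using (solve-∀)
  open import Relation.Binary.Reasoning.Setoid ≋-setoid

  infix 4 _∣≋_
  record _∣≋_ (g h : Poly) : Set where
    constructor _,_
    field
      quotient : Poly
      equality : g *ₚ quotient ≋ h

  ∣ₚ⇒∣≋ : ∀ {g h} → g ∣ₚ h → g ∣≋ h
  ∣ₚ⇒∣≋ (q , e) = q , ⟦ e ⟧

  ∣≋-resp : ∀ {g g' h h'} → g ≋ g' → h ≋ h' → g ∣≋ h → g' ∣≋ h'
  ∣≋-resp {g} e f (q , d) = q , ≋-trans (*-congʳ q (≋-sym e)) (≋-trans d f)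

  ∣≋-respʳ : ∀ {g h h'} → h ≋ h' → g ∣≋ h → g ∣≋ h'
  ∣≋-respʳ = ∣≋-resp ≋-refl

  ∣≋-trans : ∀ {a b c} → a ∣≋ b → b ∣≋ c → a ∣≋ c
  ∣≋-trans {a} (q , e) (r , f) = q *ₚ r , ≋-trans (≋-sym (*-assoc a q r)) (≋-trans (*-congʳ r e) f)

  ∣≋-*ʳ : ∀ {a b} c → a ∣≋ b → a ∣≋ b *ₚ c
  ∣≋-*ʳ {a} c (q , e) = q *ₚ c , ≋-trans (≋-sym (*-assoc a q c)) (*-congʳ c e)

  ∣≋-sub : ∀ {a b c} → a ∣≋ b → a ∣≋ c → a ∣≋ b -ₚ c
  ∣≋-sub {a} (q , e) (r , f) = q -ₚ r , ≋-trans (distrib a q r) (+-cong e (neg-cong f))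
    where
    distrib : ∀ A Q R → A *ₚ (Q -ₚ R) ≋ A *ₚ Q -ₚ A *ₚ R
    distrib = solve-∀ ℤ[z]-almost

  ^-suc-∣≋⇒∣≋ : ∀ g n {h} → g ^ₚ suc n ∣≋ h → g ∣≋ h
  ^-suc-∣≋⇒∣≋ g n (q , e) = g ^ₚ n *ₚ q , ≋-trans (≋-sym (*-assoc g (g ^ₚ n) q)) e

  X^-1∣X^*-1 : ∀ a t → X^ a -ₚ oneₚ ∣≋ X^ (t ℕ.* a) -ₚ oneₚ
  X^-1∣X^*-1 a zero    = [] , ≋-trans (*-zeroʳ (X^ a -ₚ oneₚ)) (≋-sym (+-inverseʳ oneₚ))
  X^-1∣X^*-1 a (suc t) with X^-1∣X^*-1 a t
  ... | q , e = X^ a *ₚ q +ₚ oneₚ , (begin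
    (X^ a -ₚ oneₚ) *ₚ (X^ a *ₚ q +ₚ oneₚ)
      ≈⟨ expand (X^ a) q ⟩
    X^ a *ₚ ((X^ a -ₚ oneₚ) *ₚ q) +ₚ (X^ a -ₚ oneₚ)
      ≈⟨ +-cong (*-congˡ (X^ a) e) ≋-refl ⟩
    X^ a *ₚ (X^ (t ℕ.* a) -ₚ oneₚ) +ₚ (X^ a -ₚ oneₚ)
      ≈⟨ telescope (X^ a) (X^ (t ℕ.* a)) ⟩
    X^ a *ₚ X^ (t ℕ.* a) -ₚ oneₚ
      ≈⟨ +-cong (X^-+ a (t ℕ.* a)) ≋-refl ⟨
    X^ (suc t ℕ.* a) -ₚ oneₚ ∎)
    where
    expand : ∀ A Q → (A -ₚ oneₚ) *ₚ (A *ₚ Q +ₚ oneₚ) ≋ A *ₚ ((A -ₚ oneₚ) *ₚ Q) +ₚ (A -ₚ oneₚ)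
    expand = solve-∀ ℤ[z]-almost
    telescope : ∀ A B → A *ₚ (B -ₚ oneₚ) +ₚ (A -ₚ oneₚ) ≋ A *ₚ B -ₚ oneₚ
    telescope = solve-∀ ℤ[z]-almost

  θ⟨⟩-lowers-multiplicity : ∀ g n h s → g ^ₚ suc n ∣≋ h → g ^ₚ n ∣≋ θ⟨ s ⟩ h
  θ⟨⟩-lowers-multiplicity g n h s (q , e) = w , (begin
    g ^ₚ n *ₚ w
      ≈⟨ expand (g ^ₚ n) (const (ℤ.+ suc n)) (θ g) q g (θ q) (const s) ⟩
    (const (ℤ.+ suc n) *ₚ g ^ₚ n *ₚ θ g *ₚ q +ₚ g ^ₚ suc n *ₚ θ q) -ₚ const s *ₚ (g ^ₚ suc n *ₚ q)
      ≈⟨ +-cong (+-cong (*-congʳ q (θ-^-suc g n)) ≋-refl) ≋-refl ⟨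
    (θ (g ^ₚ suc n) *ₚ q +ₚ g ^ₚ suc n *ₚ θ q) -ₚ const s *ₚ (g ^ₚ suc n *ₚ q)
      ≈⟨ +-cong (θ-* (g ^ₚ suc n) q) ≋-refl ⟨
    θ⟨ s ⟩ (g ^ₚ suc n *ₚ q)
      ≈⟨ θ⟨⟩-cong s e ⟩
    θ⟨ s ⟩ h ∎)
    where
    w = (const (ℤ.+ suc n) *ₚ θ g *ₚ q +ₚ g *ₚ θ q) -ₚ const s *ₚ g *ₚ q
    expand : ∀ G A T Q g' TQ S →
      G *ₚ ((A *ₚ T *ₚ Q +ₚ g' *ₚ TQ) -ₚ S *ₚ g' *ₚ Q) ≋ (A *ₚ G *ₚ T *ₚ Q +ₚ g' *ₚ G *ₚ TQ) -ₚ S *ₚ (g' *ₚ G *ₚ Q)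
    expand = solve-∀ ℤ[z]-almost


module Substitution where

  open PolynomialRing
  open EulerOperator
  open import Data.Nat as ℕ using (zero; suc)
  open import Data.Integer as ℤ using (ℤ; 0ℤ; 1ℤ; _*_; -_)
  import Data.Integer.Properties as ℤP
  open import Data.List using (_∷_)
  open import Tactic.RingSolver using (solve-∀)
  open import Relation.Binary.PropositionalEquality using (sym; trans)
  open import Relation.Binary.Reasoning.Setoid ≋-setoid

  infixl 9 _[z^_]
  _[z^_] : Poly → ℕ → Poly
  f [z^ D ] = f ∘ₚ X^ D

  [z^]-≋[] : ∀ D f → f ≋ [] → f [z^ D ] ≋ []
  [z^]-≋[] D []      e = ≋-refl
  [z^]-≋[] D (a ∷ f) e = begin
    const a +ₚ X^ D *ₚ f [z^ D ]  ≈⟨ +-cong (const-cong (at e zero)) (*-congˡ (X^ D) ([z^]-≋[] D f ⟦ (λ i → at e (suc i)) ⟧)) ⟩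
    const 0ℤ +ₚ X^ D *ₚ []        ≈⟨ +-cong const-0 (*-zeroʳ (X^ D)) ⟩
    [] +ₚ []                      ∎

  [z^]-cong : ∀ D {f f'} → f ≋ f' → f [z^ D ] ≋ f' [z^ D ]
  [z^]-cong D {[]}    {f'}     e = ≋-sym ([z^]-≋[] D f' (≋-sym e))
  [z^]-cong D {a ∷ f} {[]}     e = [z^]-≋[] D (a ∷ f) e
  [z^]-cong D {a ∷ f} {b ∷ f'} e =
    +-cong (const-cong (at e zero)) (*-congˡ (X^ D) ([z^]-cong D (∷-tail e)))

  [z^]-+ : ∀ D f g → (f +ₚ g) [z^ D ] ≋ f [z^ D ] +ₚ g [z^ D ]
  [z^]-+ D []      g       = ≋-refl
  [z^]-+ D (a ∷ f) []      = ≋-sym (+-identityʳ ((a ∷ f) [z^ D ]))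
  [z^]-+ D (a ∷ f) (b ∷ g) = ≋-trans
    (+-cong (const-+ a b) (*-congˡ (X^ D) ([z^]-+ D f g)))
    (regroup (const a) (const b) (X^ D) (f [z^ D ]) (g [z^ D ]))
    where
    regroup : ∀ A B X F G → (A +ₚ B) +ₚ X *ₚ (F +ₚ G) ≋ (A +ₚ X *ₚ F) +ₚ (B +ₚ X *ₚ G)
    regroup = solve-∀ ℤ[z]-almost

  [z^]-scale : ∀ D a f → (scale a f) [z^ D ] ≋ const a *ₚ f [z^ D ]
  [z^]-scale D a []      = ≋-sym (*-zeroʳ (const a))
  [z^]-scale D a (b ∷ f) = ≋-trans
    (+-cong (const-* a b) (*-congˡ (X^ D) ([z^]-scale D a f)))
    (factor (const a) (const b) (X^ D) (f [z^ D ]))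
    where
    factor : ∀ A B X F → A *ₚ B +ₚ X *ₚ (A *ₚ F) ≋ A *ₚ (B +ₚ X *ₚ F)
    factor = solve-∀ ℤ[z]-almost

  [z^]-const-*ₚ : ∀ D a f → (const a *ₚ f) [z^ D ] ≋ const a *ₚ f [z^ D ]
  [z^]-const-*ₚ D a f = ≋-trans ([z^]-cong D (const-*ₚ a f)) ([z^]-scale D a f)

  [z^]-neg : ∀ D f → (negₚ f) [z^ D ] ≋ negₚ (f [z^ D ])
  [z^]-neg D f = begin
    (negₚ f) [z^ D ]             ≈⟨ [z^]-cong D (neg≋scale f) ⟩
    (scale (- 1ℤ) f) [z^ D ]     ≈⟨ [z^]-scale D (- 1ℤ) f ⟩
    const (- 1ℤ) *ₚ f [z^ D ]    ≈⟨ const-*ₚ (- 1ℤ) (f [z^ D ]) ⟩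
    scale (- 1ℤ) (f [z^ D ])     ≈⟨ neg≋scale (f [z^ D ]) ⟨
    negₚ (f [z^ D ])             ∎
    where
    neg≋scale : ∀ p → negₚ p ≋ scale (- 1ℤ) p
    neg≋scale p = ⟦ (λ i → trans (coeff-neg p i)
      (trans (sym (ℤP.-1*i≡-i (coeff p i))) (sym (coeff-scale (- 1ℤ) p i)))) ⟧

  [z^]-X^1-*ₚ : ∀ D h → (X^ 1 *ₚ h) [z^ D ] ≋ X^ D *ₚ h [z^ D ]
  [z^]-X^1-*ₚ D h = ≋-trans ([z^]-cong D (X^1-*ₚ h)) (+-cong const-0 ≋-refl)

  X^-[z^] : ∀ D L → (X^ L) [z^ D ] ≋ X^ (L ℕ.* D)
  X^-[z^] D zero    = ≋-trans (+-cong ≋-refl (*-zeroʳ (X^ D))) (+-identityʳ oneₚ)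
  X^-[z^] D (suc L) = begin
    const 0ℤ +ₚ X^ D *ₚ (X^ L) [z^ D ]  ≈⟨ +-cong const-0 (*-congˡ (X^ D) (X^-[z^] D L)) ⟩
    X^ D *ₚ X^ (L ℕ.* D)                ≈⟨ X^-+ D (L ℕ.* D) ⟨
    X^ (D ℕ.+ L ℕ.* D)                  ∎

  θ-[z^] : ∀ D f → θ (f [z^ D ]) ≋ const (ℤ.+ D) *ₚ (θ f) [z^ D ]
  θ-[z^] D []      = ≋-sym (*-zeroʳ (const (ℤ.+ D)))
  θ-[z^] D (a ∷ f) = begin
    θ (const a +ₚ X^ D *ₚ f [z^ D ])
      ≈⟨ θ-+ (const a) (X^ D *ₚ f [z^ D ]) ⟩
    θ (const a) +ₚ θ (X^ D *ₚ f [z^ D ])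
      ≈⟨ +-cong (θ-const a) (θ-* (X^ D) (f [z^ D ])) ⟩
    θ (X^ D) *ₚ f [z^ D ] +ₚ X^ D *ₚ θ (f [z^ D ])
      ≈⟨ +-cong (*-congʳ (f [z^ D ]) (θ-X^ D)) (*-congˡ (X^ D) (θ-[z^] D f)) ⟩
    const (ℤ.+ D) *ₚ X^ D *ₚ f [z^ D ] +ₚ X^ D *ₚ (const (ℤ.+ D) *ₚ (θ f) [z^ D ])
      ≈⟨ factor (const (ℤ.+ D)) (X^ D) (f [z^ D ]) ((θ f) [z^ D ]) ⟩
    const (ℤ.+ D) *ₚ (X^ D *ₚ (f [z^ D ] +ₚ (θ f) [z^ D ]))
      ≈⟨ *-congˡ (const (ℤ.+ D)) (≋-trans ([z^]-X^1-*ₚ D (f +ₚ θ f)) (*-congˡ (X^ D) ([z^]-+ D f (θ f)))) ⟨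
    const (ℤ.+ D) *ₚ (X^ 1 *ₚ (f +ₚ θ f)) [z^ D ]
      ≈⟨ *-congˡ (const (ℤ.+ D)) ([z^]-cong D (θ-∷ a f)) ⟨
    const (ℤ.+ D) *ₚ (θ (a ∷ f)) [z^ D ] ∎
    where
    factor : ∀ K X F G → K *ₚ X *ₚ F +ₚ X *ₚ (K *ₚ G) ≋ K *ₚ (X *ₚ (F +ₚ G))
    factor = solve-∀ ℤ[z]-almost

  θ⟨⟩-[z^] : ∀ D L f → θ⟨ ℤ.+ (L ℕ.* D) ⟩ (f [z^ D ]) ≋ const (ℤ.+ D) *ₚ (θ⟨ ℤ.+ L ⟩ f) [z^ D ]
  θ⟨⟩-[z^] D L f = begin
    θ (f [z^ D ]) -ₚ const (ℤ.+ (L ℕ.* D)) *ₚ f [z^ D ]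
      ≈⟨ +-cong (θ-[z^] D f) (neg-cong (*-congʳ (f [z^ D ])
           (≋-trans (const-cong (ℤP.pos-* L D)) (const-* (ℤ.+ L) (ℤ.+ D))))) ⟩
    const (ℤ.+ D) *ₚ (θ f) [z^ D ] -ₚ const (ℤ.+ L) *ₚ const (ℤ.+ D) *ₚ f [z^ D ]
      ≈⟨ factor (const (ℤ.+ D)) (const (ℤ.+ L)) ((θ f) [z^ D ]) (f [z^ D ]) ⟩
    const (ℤ.+ D) *ₚ ((θ f) [z^ D ] -ₚ const (ℤ.+ L) *ₚ f [z^ D ])
      ≈⟨ *-congˡ (const (ℤ.+ D)) (≋-trans ([z^]-+ D (θ f) (negₚ (const (ℤ.+ L) *ₚ f)))
           (+-cong ≋-refl (≋-trans ([z^]-neg D (const (ℤ.+ L) *ₚ f)) (neg-cong ([z^]-const-*ₚ D (ℤ.+ L) f))))) ⟨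
    const (ℤ.+ D) *ₚ (θ⟨ ℤ.+ L ⟩ f) [z^ D ] ∎
    where
    factor : ∀ KD KL A B → KD *ₚ A -ₚ KL *ₚ KD *ₚ B ≋ KD *ₚ (A -ₚ KL *ₚ B)
    factor = solve-∀ ℤ[z]-almost


module Degree where

  open PolynomialRing
  open import Data.Nat as ℕ using (zero; suc; z≤n; s≤s)
  import Data.Nat.Properties as ℕP
  open import Data.Integer using (0ℤ; 1ℤ; _+_; _*_)
  import Data.Integer.Properties as ℤP
  open import Data.List using (_∷_; length)
  open import Data.Product using (Σ; _×_; _,_; proj₁; proj₂)
  open import Data.Sum using (inj₁; inj₂)
  open import Data.Empty using (⊥-elim)
  open import Relation.Nullary using (Dec; yes; no)
  open import Relation.Binary.PropositionalEquality

  VanishesFrom : Poly → ℕ → Set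
  VanishesFrom p N = ∀ i → N ≤ i → coeff p i ≡ 0ℤ

  HasDegree : Poly → ℕ → Set
  HasDegree p s = (coeff p s ≢ 0ℤ) × VanishesFrom p (suc s)

  Monic : Poly → ℕ → Set
  Monic p s = (coeff p s ≡ 1ℤ) × VanishesFrom p (suc s)

  *-≢0 : ∀ {a b} → a ≢ 0ℤ → b ≢ 0ℤ → a * b ≢ 0ℤ
  *-≢0 {a} a≢0 b≢0 ab≡0 with ℤP.i*j≡0⇒i≡0∨j≡0 a ab≡0
  ... | inj₁ a≡0 = a≢0 a≡0
  ... | inj₂ b≡0 = b≢0 b≡0

  monic⇒hasDegree : ∀ p {s} → Monic p s → HasDegree p s
  monic⇒hasDegree p (lead , vanish) = (λ lead≡0 → 1≢0 (trans (sym lead) lead≡0)) , vanish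
    where
    1≢0 : 1ℤ ≢ 0ℤ
    1≢0 ()

  vanishesFrom-resp : ∀ {p q N} → p ≋ q → VanishesFrom p N → VanishesFrom q N
  vanishesFrom-resp e v i le = trans (sym (at e i)) (v i le)

  vanishesFrom-length : ∀ p → VanishesFrom p (length p)
  vanishesFrom-length []      i       _         = refl
  vanishesFrom-length (a ∷ p) (suc i) (s≤s le) = vanishesFrom-length p i le

  vanishesFrom-0 : ∀ {p} → VanishesFrom p 0 → p ≋ []
  vanishesFrom-0 v = ⟦ (λ i → v i z≤n) ⟧

  ≋[]? : ∀ p → Dec (p ≋ [])
  ≋[]? []      = yes ≋-refl
  ≋[]? (a ∷ p) with a ℤP.≟ 0ℤ | ≋[]? p
  ... | yes a≡0 | yes p≋0 = yes ⟦ (λ { zero → a≡0 ; (suc i) → at p≋0 i }) ⟧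
  ... | no  a≢0 | _       = no (λ e → a≢0 (at e zero))
  ... | yes _   | no  p≉0 = no (λ e → p≉0 ⟦ (λ i → at e (suc i)) ⟧)

  degree : ∀ p → ¬ p ≋ [] → Σ ℕ (HasDegree p)
  degree []      p≉0 = ⊥-elim (p≉0 ≋-refl)
  degree (a ∷ p) a∷p≉0 with ≋[]? p
  ... | yes p≋0 = 0 , (λ a≡0 → a∷p≉0 ⟦ (λ { zero → a≡0 ; (suc i) → at p≋0 i }) ⟧) , (λ { (suc i) _ → at p≋0 i })
  ... | no  p≉0 with degree p p≉0
  ...   | s , top , vanish = suc s , top , (λ { (suc i) (s≤s le) → vanish i le })

  degree-≤ : ∀ p {s t} → HasDegree p s → VanishesFrom p (suc t) → s ≤ t
  degree-≤ p {s} {t} (top , _) v with s ℕP.≤? t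
  ... | yes s≤t = s≤t
  ... | no  s≰t = ⊥-elim (top (v s (ℕP.≰⇒> s≰t)))

  degree-unique : ∀ p {s t} → HasDegree p s → HasDegree p t → s ≡ t
  degree-unique p ds dt = ℕP.≤-antisym (degree-≤ p ds (proj₂ dt)) (degree-≤ p dt (proj₂ ds))

  leading-* : ∀ p q s u → VanishesFrom p (suc s) → VanishesFrom q (suc u) →
              coeff (p *ₚ q) (s ℕ.+ u) ≡ coeff p s * coeff q u × VanishesFrom (p *ₚ q) (suc (s ℕ.+ u))
  leading-* []      q s       u vp vq = refl , (λ i _ → refl)
  leading-* (a ∷ p) q zero    u vp vq = top , vanish
    where
    pq≋0 : p *ₚ q ≋ []
    pq≋0 = *-zeroˡ-≋ p q ⟦ (λ i → vp (suc i) (s≤s z≤n)) ⟧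
    top : coeff ((a ∷ p) *ₚ q) u ≡ a * coeff q u
    top = trans (coeff-∷* a p q u) (trans (cong (a * coeff q u +_) (shifted u)) (ℤP.+-identityʳ _))
      where
      shifted : ∀ i → coeff (0ℤ ∷ (p *ₚ q)) i ≡ 0ℤ
      shifted zero    = refl
      shifted (suc i) = at pq≋0 i
    vanish : VanishesFrom ((a ∷ p) *ₚ q) (suc u)
    vanish (suc i) (s≤s le) = trans (coeff-∷* a p q (suc i))
      (trans (cong₂ _+_ (cong (a *_) (vq (suc i) (s≤s le))) (at pq≋0 i)) (cong (_+ 0ℤ) (ℤP.*-zeroʳ a)))
  leading-* (a ∷ p) q (suc s) u vp vq = top , vanish
    where
    ih = leading-* p q s u (λ i le → vp (suc i) (s≤s le)) vq
    a*q≡0 : ∀ i → s ℕ.+ u ≤ i → a * coeff q (suc i) ≡ 0ℤ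
    a*q≡0 i le = trans (cong (a *_) (vq (suc i) (s≤s (ℕP.≤-trans (ℕP.m≤n+m u s) le)))) (ℤP.*-zeroʳ a)
    top : coeff ((a ∷ p) *ₚ q) (suc (s ℕ.+ u)) ≡ coeff p s * coeff q u
    top = trans (coeff-∷* a p q (suc (s ℕ.+ u)))
      (trans (cong₂ _+_ (a*q≡0 (s ℕ.+ u) ℕP.≤-refl) (proj₁ ih)) (ℤP.+-identityˡ _))
    vanish : VanishesFrom ((a ∷ p) *ₚ q) (suc (suc (s ℕ.+ u)))
    vanish (suc i) (s≤s le) = trans (coeff-∷* a p q (suc i))
      (cong₂ _+_ (a*q≡0 i (ℕP.≤-trans (ℕP.n≤1+n _) le)) (proj₂ ih i le))

  hasDegree-* : ∀ p q {s u} → HasDegree p s → HasDegree q u → HasDegree (p *ₚ q) (s ℕ.+ u)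
  hasDegree-* p q {s} {u} (tp , vp) (tq , vq) =
    (λ top≡0 → *-≢0 tp tq (trans (sym (proj₁ lead)) top≡0)) , proj₂ lead
    where lead = leading-* p q s u vp vq

  monic-* : ∀ p q {s u} → Monic p s → Monic q u → Monic (p *ₚ q) (s ℕ.+ u)
  monic-* p q {s} {u} (lp , vp) (lq , vq) =
    trans (proj₁ lead) (cong₂ _*_ lp lq) , proj₂ lead
    where lead = leading-* p q s u vp vq

  coeff-X^-self : ∀ n → coeff (X^ n) n ≡ 1ℤ
  coeff-X^-self zero    = refl
  coeff-X^-self (suc n) = coeff-X^-self n

  coeff-X^-other : ∀ n i → i ≢ n → coeff (X^ n) i ≡ 0ℤ
  coeff-X^-other zero    zero    i≢n = ⊥-elim (i≢n refl)
  coeff-X^-other zero    (suc i) i≢n = refl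
  coeff-X^-other (suc n) zero    i≢n = refl
  coeff-X^-other (suc n) (suc i) i≢n = coeff-X^-other n i (λ e → i≢n (cong suc e))


module MultiplicityBound where

  open PolynomialRing
  open EulerOperator
  open Divisibility
  open Substitution
  open Degree
  open import Data.Nat as ℕ using (zero; suc; _<_; z≤n; s≤s)
  import Data.Nat.Properties as ℕP
  open import Data.Integer as ℤ using (ℤ; 0ℤ; 1ℤ; _+_; _*_; -_)
  import Data.Integer.Properties as ℤP
  open import Data.List using (length)
  open import Data.Product using (_,_; proj₁)
  open import Data.Sum using (inj₁; inj₂)
  open import Data.Empty using (⊥-elim)
  open import Relation.Nullary using (yes; no)
  open import Relation.Binary.PropositionalEquality using (_≡_; _≢_; refl; sym; trans; cong; subst)
  open import Tactic.RingSolver using (solve-∀)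
  open import Relation.Binary.Reasoning.Setoid ≋-setoid

  θ⟨⟩-const-*ₚ : ∀ s c h → θ⟨ s ⟩ (const c *ₚ h) ≋ const c *ₚ θ⟨ s ⟩ h
  θ⟨⟩-const-*ₚ s c h = ≋-trans (+-cong (θ-const-*ₚ c h) ≋-refl) (factor (const c) (const s) (θ h) h)
    where
    factor : ∀ C S T H → C *ₚ T -ₚ S *ₚ (C *ₚ H) ≋ C *ₚ (T -ₚ S *ₚ H)
    factor = solve-∀ ℤ[z]-almost

  θ⟨⟩-vanishesFrom : ∀ L f → VanishesFrom f (suc L) → VanishesFrom (θ⟨ ℤ.+ L ⟩ f) L
  θ⟨⟩-vanishesFrom L f v i L≤i with i ℕP.≟ L
  ... | yes refl = trans (coeff-θ⟨⟩ (ℤ.+ L) f L) (cong (_* coeff f L) (ℤP.+-inverseʳ (ℤ.+ L)))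
  ... | no  i≢L  = trans (coeff-θ⟨⟩ (ℤ.+ L) f i)
    (trans (cong ((ℤ.+ i + - ℤ.+ L) *_) (v i (ℕP.≤∧≢⇒< L≤i (λ e → i≢L (sym e))))) (ℤP.*-zeroʳ (ℤ.+ i + - ℤ.+ L)))

  θ⟨⟩-kernel : ∀ L f → θ⟨ ℤ.+ L ⟩ f ≋ [] → f ≋ scale (coeff f L) (X^ L)
  θ⟨⟩-kernel L f θf≋0 = ⟦ coeffwise ⟧
    where
    coeffwise : ∀ i → coeff f i ≡ coeff (scale (coeff f L) (X^ L)) i
    coeffwise i with i ℕP.≟ L
    ... | yes refl = sym (trans (coeff-scale (coeff f L) (X^ L) L)
                       (trans (cong (coeff f L *_) (coeff-X^-self L)) (ℤP.*-identityʳ (coeff f L))))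
    ... | no i≢L with ℤP.i*j≡0⇒i≡0∨j≡0 (ℤ.+ i + - ℤ.+ L) (trans (sym (coeff-θ⟨⟩ (ℤ.+ L) f i)) (at θf≋0 i))
    ...   | inj₁ i-L≡0 = ⊥-elim (i≢L (ℤP.+-injective (ℤP.i-j≡0⇒i≡j _ _ i-L≡0)))
    ...   | inj₂ fᵢ≡0  = trans fᵢ≡0 (sym (trans (coeff-scale (coeff f L) (X^ L) i)
                           (trans (cong (coeff f L *_) (coeff-X^-other L i i≢L)) (ℤP.*-zeroʳ (coeff f L)))))

  module _ {g deg N} (deg≥1 : 1 ≤ deg) (g-deg : HasDegree g deg) (g∣ : g ∣≋ X^ (suc N) -ₚ oneₚ) where

    ∤const : ∀ c → c ≢ 0ℤ → ¬ g ∣≋ const c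
    ∤const c c≢0 (q , e) with ≋[]? q
    ... | yes q≋0 = c≢0 (at (≋-trans (≋-sym e) (≋-trans (*-congˡ g q≋0) (*-zeroʳ g))) zero)
    ... | no  q≉0 with degree q q≉0
    ...   | u , q-deg = proj₁ (hasDegree-* g q g-deg q-deg)
                          (trans (at e (deg ℕ.+ u)) (above-0 (deg ℕ.+ u) (ℕP.≤-trans deg≥1 (ℕP.m≤m+n deg u))))
      where
      above-0 : ∀ i → 1 ≤ i → coeff (const c) i ≡ 0ℤ
      above-0 (suc i) _ = refl

    -- Since g ∣ z^(N+1) - 1, it also divides c z^(j(N+1)) - c, hence c if it divides c z^j.
    ∤const-*-X^ : ∀ c → c ≢ 0ℤ → ∀ j → ¬ g ∣≋ const c *ₚ X^ j
    ∤const-*-X^ c c≢0 j g∣cz^j = ∤const c c≢0 (∣≋-respʳ difference (∣≋-sub g∣cz^jN′ g∣cz^jN′-c))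
      where
      g∣cz^jN′-c : g ∣≋ (X^ (j ℕ.* suc N) -ₚ oneₚ) *ₚ const c
      g∣cz^jN′-c = ∣≋-*ʳ (const c) (∣≋-trans g∣ (X^-1∣X^*-1 (suc N) j))
      g∣cz^jN′ : g ∣≋ const c *ₚ X^ j *ₚ X^ (N ℕ.* j)
      g∣cz^jN′ = ∣≋-*ʳ (X^ (N ℕ.* j)) g∣cz^j
      exponent : X^ (j ℕ.* suc N) ≋ X^ j *ₚ X^ (N ℕ.* j)
      exponent = subst (λ n → X^ n ≋ X^ j *ₚ X^ (N ℕ.* j)) (ℕP.*-comm (suc N) j) (X^-+ j (N ℕ.* j))
      cancel : ∀ C P Q → C *ₚ P *ₚ Q -ₚ (P *ₚ Q -ₚ oneₚ) *ₚ C ≋ oneₚ *ₚ C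
      cancel = solve-∀ ℤ[z]-almost
      difference : const c *ₚ X^ j *ₚ X^ (N ℕ.* j) -ₚ (X^ (j ℕ.* suc N) -ₚ oneₚ) *ₚ const c ≋ const c
      difference = ≋-trans
        (+-cong (≋-refl {const c *ₚ X^ j *ₚ X^ (N ℕ.* j)}) (neg-cong (*-congʳ (const c) (+-cong exponent ≋-refl))))
        (≋-trans (cancel (const c) (X^ j) (X^ (N ℕ.* j))) (*-identityˡ (const c)))

    module _ {D} (D≥1 : 1 ≤ D) where

      ^∣const-*-[z^]⇒< : ∀ L f → VanishesFrom f L → ¬ f ≋ [] → ∀ c → c ≢ 0ℤ →
                         ∀ n → g ^ₚ n ∣≋ const c *ₚ f [z^ D ] → n < L
      ^∣const-*-[z^]⇒< zero    f v f≉0 c c≢0 n       g^n∣ = ⊥-elim (f≉0 (vanishesFrom-0 v))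
      ^∣const-*-[z^]⇒< (suc L) f v f≉0 c c≢0 zero    g^n∣ = s≤s z≤n
      ^∣const-*-[z^]⇒< (suc L) f v f≉0 c c≢0 (suc n) g^n∣ with ≋[]? (θ⟨ ℤ.+ L ⟩ f)
      ... | yes θf≋0 = ⊥-elim (∤const-*-X^ (c * a) (*-≢0 c≢0 a≢0) (L ℕ.* D)
                                 (∣≋-respʳ monomial (^-suc-∣≋⇒∣≋ g n g^n∣)))
        where
        a = coeff f L
        f≋az^L = θ⟨⟩-kernel L f θf≋0
        a≢0 : a ≢ 0ℤ
        a≢0 a≡0 = f≉0 (≋-trans f≋az^L ⟦ (λ i → trans (coeff-scale a (X^ L) i) (cong (_* coeff (X^ L) i) a≡0)) ⟧)
        monomial : const c *ₚ f [z^ D ] ≋ const (c * a) *ₚ X^ (L ℕ.* D)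
        monomial = begin
          const c *ₚ f [z^ D ]                     ≈⟨ *-congˡ (const c) ([z^]-cong D f≋az^L) ⟩
          const c *ₚ (scale a (X^ L)) [z^ D ]      ≈⟨ *-congˡ (const c) ([z^]-scale D a (X^ L)) ⟩
          const c *ₚ (const a *ₚ (X^ L) [z^ D ])   ≈⟨ *-congˡ (const c) (*-congˡ (const a) (X^-[z^] D L)) ⟩
          const c *ₚ (const a *ₚ X^ (L ℕ.* D))     ≈⟨ *-assoc (const c) (const a) (X^ (L ℕ.* D)) ⟨
          const c *ₚ const a *ₚ X^ (L ℕ.* D)       ≈⟨ *-congʳ (X^ (L ℕ.* D)) (const-* c a) ⟨
          const (c * a) *ₚ X^ (L ℕ.* D)            ∎
      ... | no θf≉0 = s≤s (^∣const-*-[z^]⇒< L (θ⟨ ℤ.+ L ⟩ f) (θ⟨⟩-vanishesFrom L f v) θf≉0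
                            (c * ℤ.+ D) (*-≢0 c≢0 D≢0) n (∣≋-respʳ lowered g^n∣θ⟨⟩))
        where
        D≢0 : ℤ.+ D ≢ 0ℤ
        D≢0 D≡0 = ℕP.<⇒≢ D≥1 (sym (ℤP.+-injective D≡0))
        g^n∣θ⟨⟩ = θ⟨⟩-lowers-multiplicity g n (const c *ₚ f [z^ D ]) (ℤ.+ (L ℕ.* D)) g^n∣
        lowered : θ⟨ ℤ.+ (L ℕ.* D) ⟩ (const c *ₚ f [z^ D ]) ≋ const (c * ℤ.+ D) *ₚ (θ⟨ ℤ.+ L ⟩ f) [z^ D ]
        lowered = begin
          θ⟨ ℤ.+ (L ℕ.* D) ⟩ (const c *ₚ f [z^ D ])
            ≈⟨ θ⟨⟩-const-*ₚ (ℤ.+ (L ℕ.* D)) c (f [z^ D ]) ⟩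
          const c *ₚ θ⟨ ℤ.+ (L ℕ.* D) ⟩ (f [z^ D ])
            ≈⟨ *-congˡ (const c) (θ⟨⟩-[z^] D L f) ⟩
          const c *ₚ (const (ℤ.+ D) *ₚ (θ⟨ ℤ.+ L ⟩ f) [z^ D ])
            ≈⟨ *-assoc (const c) (const (ℤ.+ D)) ((θ⟨ ℤ.+ L ⟩ f) [z^ D ]) ⟨
          const c *ₚ const (ℤ.+ D) *ₚ (θ⟨ ℤ.+ L ⟩ f) [z^ D ]
            ≈⟨ *-congʳ ((θ⟨ ℤ.+ L ⟩ f) [z^ D ]) (const-* c (ℤ.+ D)) ⟨
          const (c * ℤ.+ D) *ₚ (θ⟨ ℤ.+ L ⟩ f) [z^ D ] ∎

      ^∣[z^]⇒<length : ∀ f → ¬ f ≋ [] → ∀ n → g ^ₚ n ∣≋ f [z^ D ] → n < length f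
      ^∣[z^]⇒<length f f≉0 n g^n∣ =
        ^∣const-*-[z^]⇒< (length f) f (vanishesFrom-length f) f≉0 1ℤ (λ ()) n
          (∣≋-respʳ (≋-sym (*-identityˡ (f [z^ D ]))) g^n∣)


module LongDivision where

  open PolynomialRing
  open EulerOperator
  open Degree
  open import Data.Nat as ℕ using (zero; suc; _<_; z≤n; s≤s; _∸_; _<ᵇ_)
  import Data.Nat.Properties as ℕP
  open import Data.Integer using (0ℤ; 1ℤ; _+_; _*_; -_)
  import Data.Integer.Properties as ℤP
  open import Data.List using (_∷_; length)
  open import Data.Bool using (true; false; T)
  open import Data.Product using (Σ; _×_; _,_; proj₁; proj₂)
  open import Data.Sum using (_⊎_; inj₁; inj₂)
  open import Data.Empty using (⊥-elim)
  open import Relation.Nullary using (yes; no)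
  open import Relation.Binary.PropositionalEquality
  open import Tactic.RingSolver using (solve-∀)
  open import Relation.Binary.Reasoning.Setoid ≋-setoid

  strip-≋ : ∀ p → strip p ≋ p
  strip-≋ []      = ≋-refl
  strip-≋ (a ∷ p) with strip p | strip-≋ p
  ... | []    | e with a ℤP.≟ 0ℤ
  ...   | yes a≡0 = ⟦ (λ { zero → sym a≡0 ; (suc i) → at e i }) ⟧
  ...   | no  _   = ∷-cong refl e
  strip-≋ (a ∷ p) | _ ∷ _ | e = ∷-cong refl e

  lastCoeff-strip≢0 : ∀ p → strip p ≡ [] ⊎ lastCoeff (strip p) ≢ 0ℤ
  lastCoeff-strip≢0 []      = inj₁ refl
  lastCoeff-strip≢0 (a ∷ p) with strip p | lastCoeff-strip≢0 p
  ... | []    | _ with a ℤP.≟ 0ℤ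
  ...   | yes _   = inj₁ refl
  ...   | no  a≢0 = inj₂ a≢0
  lastCoeff-strip≢0 (a ∷ p) | _ ∷ _ | inj₂ last≢0 = inj₂ last≢0

  lastCoeff-∷ : ∀ a r → lastCoeff (a ∷ r) ≡ coeff (a ∷ r) (length r)
  lastCoeff-∷ a []      = refl
  lastCoeff-∷ a (b ∷ r) = lastCoeff-∷ b r

  strip-degree : ∀ p → strip p ≡ [] ⊎
    Σ ℕ (λ s → length (strip p) ≡ suc s × lastCoeff (strip p) ≡ coeff p s × HasDegree p s)
  strip-degree p with strip p | lastCoeff-strip≢0 p | strip-≋ p
  ... | []    | _           | _ = inj₁ refl
  ... | a ∷ r | inj₂ last≢0 | e = inj₂ (length r , refl , last≡ ,
    (λ top≡0 → last≢0 (trans last≡ top≡0)) , (λ i le → trans (sym (at e i)) (vanishesFrom-length (a ∷ r) i le)))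
    where
    last≡ = trans (lastCoeff-∷ a r) (at e (length r))

  length-strip-≤ : ∀ p N → VanishesFrom p N → length (strip p) ≤ N
  length-strip-≤ p N v with strip-degree p
  ... | inj₁ e rewrite e = z≤n
  ... | inj₂ (s , len , _ , p-deg) rewrite len = suc-s≤ N v
    where
    suc-s≤ : ∀ N → VanishesFrom p N → suc s ≤ N
    suc-s≤ zero    v = ⊥-elim (proj₁ p-deg (v s z≤n))
    suc-s≤ (suc N) v = s≤s (degree-≤ p p-deg v)

  vanishesFrom-length-strip : ∀ p → VanishesFrom p (length (strip p))
  vanishesFrom-length-strip p = vanishesFrom-resp (strip-≋ p) (vanishesFrom-length (strip p))

  monic-strip : ∀ g s → Monic g s → length (strip g) ≡ suc s × lastCoeff (strip g) ≡ 1ℤ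
  monic-strip g s g-monic@(lead , _) with strip-degree g
  ... | inj₁ e = ⊥-elim (proj₁ (monic⇒hasDegree g g-monic) (trans (sym (at (strip-≋ g) s)) (cong (λ r → coeff r s) e)))
  ... | inj₂ (t , len , last , g-deg) with degree-unique g g-deg (monic⇒hasDegree g g-monic)
  ...   | refl = len , trans last lead

  coeff-shift-self : ∀ e c → coeff (shift e (c ∷ [])) e ≡ c
  coeff-shift-self zero    c = refl
  coeff-shift-self (suc e) c = coeff-shift-self e c

  shift-vanishesFrom : ∀ e c → VanishesFrom (shift e (c ∷ [])) (suc e)
  shift-vanishesFrom zero    c (suc i) _        = refl
  shift-vanishesFrom (suc e) c (suc i) (s≤s le) = shift-vanishesFrom e c i le

  -- Each step of divF cancels the leading term of the dividend, so n steps suffice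
  -- once the dividend has length at most n + s.
  divF-correct : ∀ n g s → Monic g s → ∀ p → length (strip p) ≤ n ℕ.+ s →
                 Σ Poly (λ r → p ≋ g *ₚ divF n p g +ₚ r × VanishesFrom r s)
  divF-correct zero g s g-monic p le =
    p , ≋-sym (+-cong (*-zeroʳ g) ≋-refl) , (λ i le' → vanishesFrom-length-strip p i (ℕP.≤-trans le le'))
  divF-correct (suc n) g s g-monic p le with length (strip p) <ᵇ length (strip g) in short
  ... | true =
    p , ≋-sym (+-cong (*-zeroʳ g) ≋-refl) , (λ i le' → vanishesFrom-length-strip p i (ℕP.≤-trans lp≤s le'))
    where
    lp≤s : length (strip p) ≤ s
    lp≤s = ℕP.≤-pred (subst (length (strip p) <_) (proj₁ (monic-strip g s g-monic))
             (ℕP.<ᵇ⇒< _ _ (subst T (sym short) _)))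
  ... | false with strip-degree p
  ...   | inj₁ p≡[] = ⊥-elim (subst T short (ℕP.<⇒<ᵇ (subst₂ _<_ (sym (cong length p≡[]))
                        (sym (proj₁ (monic-strip g s g-monic))) (s≤s z≤n))))
  ...   | inj₂ (e , len , last , p-deg) = r , equation , r-vanish
    where
    P' = strip p
    G' = strip g
    lenG' : length G' ≡ suc s
    lenG' = proj₁ (monic-strip g s g-monic)
    t = shift (length P' ∸ length G') (lastCoeff P' ∷ [])
    p' = P' -ₚ t *ₚ G'
    s≤e : s ≤ e
    s≤e = ℕP.≤-pred (subst₂ _≤_ lenG' len (ℕP.≮⇒≥ (λ lt → subst T short (ℕP.<⇒<ᵇ lt))))
    e-s+s : length P' ∸ length G' ℕ.+ s ≡ e
    e-s+s = trans (cong (ℕ._+ s) (cong₂ _∸_ len lenG')) (ℕP.m∸n+n≡m s≤e)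
    G'-monic : Monic G' s
    G'-monic = trans (at (strip-≋ g) s) (proj₁ g-monic) , vanishesFrom-resp (≋-sym (strip-≋ g)) (proj₂ g-monic)
    tG' = leading-* t G' (length P' ∸ length G') s
            (shift-vanishesFrom (length P' ∸ length G') (lastCoeff P')) (proj₂ G'-monic)
    p'-vanish : VanishesFrom p' e
    p'-vanish i e≤i with i ℕP.≟ e
    ... | yes refl = trans (coeff-sub P' (t *ₚ G') e)
          (trans (cong₂ (λ x y → x + - y) (at (strip-≋ p) e) top-t*G')
          (trans (cong (λ x → coeff p e + - x) (trans (ℤP.*-identityʳ _) last)) (ℤP.+-inverseʳ (coeff p e))))
      where
      top-t*G' : coeff (t *ₚ G') e ≡ lastCoeff P' * 1ℤ
      top-t*G' = trans (cong (coeff (t *ₚ G')) (sym e-s+s))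
        (trans (proj₁ tG') (cong₂ _*_ (coeff-shift-self (length P' ∸ length G') (lastCoeff P')) (proj₁ G'-monic)))
    ... | no e≢i = trans (coeff-sub P' (t *ₚ G') i)
          (cong₂ (λ x y → x + - y) (trans (at (strip-≋ p) i) (proj₂ p-deg i e<i))
                                   (proj₂ tG' i (subst (λ j → suc j ≤ i) (sym e-s+s) e<i)))
      where
      e<i : suc e ≤ i
      e<i = ℕP.≤∧≢⇒< e≤i (λ x → e≢i (sym x))
    ih = divF-correct n G' s G'-monic p'
           (ℕP.≤-trans (length-strip-≤ p' e p'-vanish) (ℕP.≤-pred (subst (_≤ suc n ℕ.+ s) len le)))
    q = divF n p' G'
    r = proj₁ ih
    r-vanish = proj₂ (proj₂ ih)
    split : ∀ A B → A ≋ (A -ₚ B) +ₚ B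
    split = solve-∀ ℤ[z]-almost
    regroup : ∀ G Q R T → G *ₚ Q +ₚ R +ₚ T *ₚ G ≋ G *ₚ (T +ₚ Q) +ₚ R
    regroup = solve-∀ ℤ[z]-almost
    equation : p ≋ g *ₚ (t +ₚ q) +ₚ r
    equation = begin
      p                          ≈⟨ strip-≋ p ⟨
      P'                         ≈⟨ split P' (t *ₚ G') ⟩
      p' +ₚ t *ₚ G'              ≈⟨ +-cong (proj₁ (proj₂ ih)) ≋-refl ⟩
      G' *ₚ q +ₚ r +ₚ t *ₚ G'    ≈⟨ regroup G' q r t ⟩
      G' *ₚ (t +ₚ q) +ₚ r        ≈⟨ +-cong (*-congʳ (t +ₚ q) (strip-≋ g)) ≋-refl ⟩
      g *ₚ (t +ₚ q) +ₚ r         ∎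

  const-*ₚ-cancel : ∀ N r → N ≢ 0ℤ → const N *ₚ r ≋ [] → r ≋ []
  const-*ₚ-cancel N r N≢0 Nr≋0 = ⟦ rᵢ≡0 ⟧
    where
    rᵢ≡0 : ∀ i → coeff r i ≡ 0ℤ
    rᵢ≡0 i with ℤP.i*j≡0⇒i≡0∨j≡0 N (trans (sym (coeff-const-*ₚ N r i)) (at Nr≋0 i))
    ... | inj₁ N≡0 = ⊥-elim (N≢0 N≡0)
    ... | inj₂ r≡0 = r≡0

  -- A multiple of a polynomial of degree s has degree at least s, unless it is zero.
  *-vanishesFrom⇒≋[] : ∀ P s d N r → HasDegree P s → N ≢ 0ℤ → VanishesFrom r s →
                       P *ₚ d ≋ const N *ₚ r → r ≋ []
  *-vanishesFrom⇒≋[] P s d N r P-deg N≢0 r-vanish Pd≋Nr with ≋[]? d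
  ... | yes d≋0 = const-*ₚ-cancel N r N≢0 (≋-trans (≋-sym Pd≋Nr) (≋-trans (*-congˡ P d≋0) (*-zeroʳ P)))
  ... | no  d≉0 with degree d d≉0
  ...   | u , d-deg = ⊥-elim (proj₁ (hasDegree-* P d P-deg d-deg) (trans (at Pd≋Nr (s ℕ.+ u))
          (trans (coeff-const-*ₚ N r (s ℕ.+ u))
          (trans (cong (N *_) (r-vanish (s ℕ.+ u) (ℕP.m≤m+n s u))) (ℤP.*-zeroʳ N)))))

  remainder-≋[] : ∀ P s A w N q r → Monic P s → P *ₚ w ≋ const N *ₚ A → N ≢ 0ℤ →
                  A ≋ P *ₚ q +ₚ r → VanishesFrom r s → r ≋ []
  remainder-≋[] P s A w N q r P-monic Pw≋NA N≢0 A≋Pq+r r-vanish =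
    *-vanishesFrom⇒≋[] P s (w -ₚ const N *ₚ q) N r (monic⇒hasDegree P P-monic) N≢0 r-vanish (begin
      P *ₚ (w -ₚ const N *ₚ q)                   ≈⟨ expand P w (const N) q ⟩
      P *ₚ w -ₚ const N *ₚ (P *ₚ q)              ≈⟨ +-cong Pw≋NA ≋-refl ⟩
      const N *ₚ A -ₚ const N *ₚ (P *ₚ q)        ≈⟨ +-cong (*-congˡ (const N) A≋Pq+r) ≋-refl ⟩
      const N *ₚ (P *ₚ q +ₚ r) -ₚ const N *ₚ (P *ₚ q) ≈⟨ cancel P q r (const N) ⟩
      const N *ₚ r                               ∎)
    where
    expand : ∀ P W K Q → P *ₚ (W -ₚ K *ₚ Q) ≋ P *ₚ W -ₚ K *ₚ (P *ₚ Q)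
    expand = solve-∀ ℤ[z]-almost
    cancel : ∀ P Q R K → K *ₚ (P *ₚ Q +ₚ R) -ₚ K *ₚ (P *ₚ Q) ≋ K *ₚ R
    cancel = solve-∀ ℤ[z]-almost

  monic-quotient : ∀ P s A n q → Monic P s → Monic A n → A ≋ P *ₚ q → Monic q (n ∸ s) × s ℕ.+ (n ∸ s) ≡ n
  monic-quotient P s A n q (P-lead , P-vanish) A-monic@(A-lead , _) A≋Pq with ≋[]? q
  ... | yes q≋0 =
    ⊥-elim (proj₁ (monic⇒hasDegree A A-monic) (at (≋-trans A≋Pq (≋-trans (*-congˡ P q≋0) (*-zeroʳ P))) n))
  ... | no  q≉0 with degree q q≉0
  ...   | u , q-top , q-vanish =
    subst (Monic q) (sym n∸s≡u) (q-lead , q-vanish) , trans (cong (s ℕ.+_) n∸s≡u) s+u≡n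
    where
    Pq = leading-* P q s u P-vanish q-vanish
    top-Pq : coeff (P *ₚ q) (s ℕ.+ u) ≡ coeff q u
    top-Pq = trans (proj₁ Pq) (trans (cong (_* coeff q u) P-lead) (ℤP.*-identityˡ _))
    s+u≡n : s ℕ.+ u ≡ n
    s+u≡n = degree-unique A ((λ top≡0 → q-top (trans (sym top-Pq) (trans (sym (at A≋Pq (s ℕ.+ u))) top≡0))) ,
                             vanishesFrom-resp (≋-sym A≋Pq) (proj₂ Pq))
                            (monic⇒hasDegree A A-monic)
    n∸s≡u : n ∸ s ≡ u
    n∸s≡u = trans (cong (_∸ s) (sym s+u≡n)) (ℕP.m+n∸m≡n s u)
    q-lead : coeff q u ≡ 1ℤ
    q-lead = trans (sym top-Pq) (trans (sym (at A≋Pq (s ℕ.+ u))) (subst (λ i → coeff A i ≡ 1ℤ) (sym s+u≡n) A-lead))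


module Totient where

  open import Data.Nat as ℕ using (zero; suc; _<_; z≤n; s≤s; _+_; _*_)
  import Data.Nat.Properties as ℕP
  open import Data.Nat.Divisibility using (_∣_; _∣?_; divides; ∣⇒≤; ∣-refl; quotient; ∣m+n∣m⇒∣n; n∣m*n; 0∣⇒≡0)
  open import Data.Nat.GCD using (gcd; gcd[m,n]∣m; gcd[m,n]∣n; gcd-zeroˡ; c*gcd[m,n]≡gcd[cm,cn])
  open import Data.Bool using (Bool; true; false)
  open import Data.List using (List; _∷_; upTo)
  open import Data.List.Membership.Propositional using (_∈_; _∉_)
  import Data.List.Membership.Propositional.Properties as ∈
  import Data.List.Relation.Unary.All as All
  open import Data.List.Relation.Unary.Any using (here; there)
  open import Data.List.Relation.Unary.Unique.Propositional using (Unique; _∷_)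
  import Data.List.Relation.Unary.Unique.Propositional.Properties as Unique
  open import Data.Product using (_×_; _,_; proj₁; proj₂)
  open import Data.Empty using (⊥-elim)
  open import Relation.Nullary using (yes; no)
  open import Relation.Nullary.Decidable using (⌊_⌋)
  open import Relation.Binary.PropositionalEquality
  open import Data.Nat.Tactic.RingSolver using (solve-∀)

  ∈properDivisors⁻ : ∀ {e} n → e ∈ properDivisors n → e < n × e ∣ n
  ∈properDivisors⁻ n e∈ with ∈.∈-filter⁻ (_∣? n) {xs = upTo n} e∈
  ... | e∈upTo , e∣n = ∈.∈-upTo⁻ e∈upTo , e∣n

  ∈properDivisors⁺ : ∀ {e n} → e < n → e ∣ n → e ∈ properDivisors n
  ∈properDivisors⁺ {n = n} e<n e∣n = ∈.∈-filter⁺ (_∣? n) (∈.∈-upTo⁺ e<n) e∣n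

  properDivisors-unique : ∀ n → Unique (properDivisors n)
  properDivisors-unique n = Unique.filter⁺ (_∣? n) (Unique.upTo⁺ n)

  ∣-pos : ∀ {e n} → 1 ≤ n → e ∣ n → 1 ≤ e
  ∣-pos {zero}  1≤n 0∣n = ⊥-elim (ℕP.<⇒≢ 1≤n (sym (0∣⇒≡0 0∣n)))
  ∣-pos {suc e} _   _   = s≤s z≤n

  ∈properDivisors-pos : ∀ {e} n → e ∈ properDivisors n → 1 ≤ e
  ∈properDivisors-pos n e∈ with ∈properDivisors⁻ n e∈
  ... | e<n , e∣n = ∣-pos (ℕP.≤-trans (s≤s z≤n) e<n) e∣n

  ∑ : (ℕ → ℕ) → List ℕ → ℕ
  ∑ f []       = 0
  ∑ f (x ∷ xs) = f x + ∑ f xs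

  ∑-cong : ∀ {f g} xs → (∀ {x} → x ∈ xs → f x ≡ g x) → ∑ f xs ≡ ∑ g xs
  ∑-cong []       f≡g = refl
  ∑-cong (x ∷ xs) f≡g = cong₂ _+_ (f≡g (here refl)) (∑-cong xs (λ x∈ → f≡g (there x∈)))

  ∑-+ : ∀ f g xs → ∑ (λ x → f x + g x) xs ≡ ∑ f xs + ∑ g xs
  ∑-+ f g []       = refl
  ∑-+ f g (x ∷ xs) rewrite ∑-+ f g xs = interchange (f x) (g x) (∑ f xs) (∑ g xs)
    where
    interchange : ∀ a b c d → a + b + (c + d) ≡ a + c + (b + d)
    interchange = solve-∀

  ∑-0 : ∀ xs → ∑ (λ _ → 0) xs ≡ 0
  ∑-0 []       = refl
  ∑-0 (x ∷ xs) = ∑-0 xs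

  indicator : Bool → ℕ
  indicator true  = 1
  indicator false = 0

  _≡ᵇ_ : ℕ → ℕ → Bool
  x ≡ᵇ y = ⌊ x ℕP.≟ y ⌋

  count : (ℕ → Bool) → ℕ → ℕ
  count P zero    = 0
  count P (suc n) = count P n + indicator (P n)

  count-cong : ∀ {P Q} n → (∀ j → j < n → P j ≡ Q j) → count P n ≡ count Q n
  count-cong zero    P≡Q = refl
  count-cong (suc n) P≡Q =
    cong₂ _+_ (count-cong n (λ j j<n → P≡Q j (ℕP.m<n⇒m<1+n j<n))) (cong indicator (P≡Q n ℕP.≤-refl))

  ∑-indicator-∉ : ∀ x ds → x ∉ ds → ∑ (λ e → indicator (x ≡ᵇ e)) ds ≡ 0
  ∑-indicator-∉ x []       _   = refl
  ∑-indicator-∉ x (d ∷ ds) x∉ with x ℕP.≟ d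
  ... | yes x≡d = ⊥-elim (x∉ (here x≡d))
  ... | no  _   = ∑-indicator-∉ x ds (λ x∈ → x∉ (there x∈))

  ∑-indicator-∈ : ∀ x ds → Unique ds → x ∈ ds → ∑ (λ e → indicator (x ≡ᵇ e)) ds ≡ 1
  ∑-indicator-∈ x (d ∷ ds) (d∉ ∷ _) (here refl) with x ℕP.≟ x
  ... | yes _   = cong suc (∑-indicator-∉ x ds (λ x∈ → All.lookup d∉ x∈ refl))
  ... | no  x≢x = ⊥-elim (x≢x refl)
  ∑-indicator-∈ x (d ∷ ds) (d∉ ∷ u) (there x∈) with x ℕP.≟ d
  ... | yes refl = ⊥-elim (All.lookup d∉ x∈ refl)
  ... | no  _    = ∑-indicator-∈ x ds u x∈

  ∑-count-fibres : ∀ (o : ℕ → ℕ) n ds → Unique ds → (∀ j → j < n → o j ∈ ds) →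
                   ∑ (λ e → count (λ j → o j ≡ᵇ e) n) ds ≡ n
  ∑-count-fibres o zero    ds u o∈ = ∑-0 ds
  ∑-count-fibres o (suc n) ds u o∈ =
    trans (∑-+ (λ e → count (λ j → o j ≡ᵇ e) n) (λ e → indicator (o n ≡ᵇ e)) ds)
    (trans (cong₂ _+_ (∑-count-fibres o n ds u (λ j j<n → o∈ j (ℕP.m<n⇒m<1+n j<n)))
                      (∑-indicator-∈ (o n) ds u (o∈ n ℕP.≤-refl)))
           (ℕP.+-comm n 1))

  count-pos : ∀ P n j → j < n → P j ≡ true → 1 ≤ count P n
  count-pos P (suc n) j j<1+n Pj with j ℕP.≟ n
  ... | yes refl rewrite Pj = ℕP.m≤n+m 1 (count P n)
  ... | no  j≢n  = ℕP.≤-trans (count-pos P n j (ℕP.≤∧≢⇒< (ℕP.≤-pred j<1+n) j≢n) Pj) (ℕP.m≤m+n (count P n) _)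

  count-+ : ∀ P a b → count P (a + b) ≡ count P a + count (λ j → P (a + j)) b
  count-+ P a zero    = trans (cong (count P) (ℕP.+-identityʳ a)) (sym (ℕP.+-identityʳ _))
  count-+ P a (suc b) = trans (cong (count P) (ℕP.+-suc a b))
    (trans (cong (_+ indicator (P (a + b))) (count-+ P a b)) (ℕP.+-assoc (count P a) _ _))

  count-only-0 : ∀ Q m → 1 ≤ m → (∀ t → 1 ≤ t → t < m → Q t ≡ false) → count Q m ≡ indicator (Q 0)
  count-only-0 Q (suc zero)    _ Q≡false = refl
  count-only-0 Q (suc (suc m)) _ Q≡false = trans
    (cong (_+ indicator (Q (suc m)))
          (count-only-0 Q (suc m) (s≤s z≤n) (λ t 1≤t t<m → Q≡false t 1≤t (ℕP.m<n⇒m<1+n t<m))))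
    (trans (cong (λ b → indicator (Q 0) + indicator b) (Q≡false (suc m) (s≤s z≤n) ℕP.≤-refl)) (ℕP.+-identityʳ _))

  count-multiples : ∀ P m → 1 ≤ m → (∀ j → P j ≡ true → m ∣ j) → ∀ e → count P (e * m) ≡ count (λ i → P (i * m)) e
  count-multiples P m 1≤m P⇒m∣ zero    = refl
  count-multiples P m 1≤m P⇒m∣ (suc e) = trans (cong (count P) (ℕP.+-comm m (e * m)))
    (trans (count-+ P (e * m) m)
    (cong₂ _+_ (count-multiples P m 1≤m P⇒m∣ e)
      (trans (count-only-0 (λ t → P (e * m + t)) m 1≤m not-multiple)
             (cong (λ x → indicator (P x)) (ℕP.+-identityʳ (e * m))))))
    where
    not-multiple : ∀ t → 1 ≤ t → t < m → P (e * m + t) ≡ false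
    not-multiple t 1≤t t<m with P (e * m + t) in Pt
    ... | false = refl
    ... | true  = ⊥-elim (ℕP.<⇒≱ t<m (∣⇒≤ ⦃ ℕ.>-nonZero 1≤t ⦄ (∣m+n∣m⇒∣n (P⇒m∣ (e * m + t) Pt) (n∣m*n e))))

  -- j = 0 is counted only for n = 1, as gcd 0 n ≡ n.
  φ : ℕ → ℕ
  φ n = count (λ j → gcd j n ≡ᵇ 1) n

  module _ (n : ℕ) (1≤n : 1 ≤ n) where

    gcd∣n : ∀ j → gcd j n ∣ n
    gcd∣n j = gcd[m,n]∣n j n

    -- The order of j in ℤ/n, namely n / gcd j n.
    ord : ℕ → ℕ
    ord j = quotient (gcd∣n j)

    n≡ord*gcd : ∀ j → n ≡ ord j * gcd j n
    n≡ord*gcd j = _∣_.equality (gcd∣n j)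

    ord∣n : ∀ j → ord j ∣ n
    ord∣n j = divides (gcd j n) (trans (n≡ord*gcd j) (ℕP.*-comm (ord j) (gcd j n)))

    ord∈divisors : ∀ j → ord j ∈ n ∷ properDivisors n
    ord∈divisors j with ord j ℕP.≟ n
    ... | yes ord≡n = here ord≡n
    ... | no  ord≢n = there (∈properDivisors⁺ (ℕP.≤∧≢⇒< (∣⇒≤ ⦃ ℕ.>-nonZero 1≤n ⦄ (ord∣n j)) ord≢n) (ord∣n j))

    ord≡ᵇ : ∀ e m → n ≡ m * e → 1 ≤ e → 1 ≤ m → ∀ j → (ord j ≡ᵇ e) ≡ (gcd j n ≡ᵇ m)
    ord≡ᵇ e m n≡m*e 1≤e 1≤m j with ord j ℕP.≟ e | gcd j n ℕP.≟ m
    ... | yes _      | yes _      = refl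
    ... | no  _      | no  _      = refl
    ... | yes ord≡e  | no  gcd≢m = ⊥-elim (gcd≢m (ℕP.*-cancelˡ-≡ (gcd j n) m e ⦃ ℕ.>-nonZero 1≤e ⦄
          (trans (sym (trans (n≡ord*gcd j) (cong (_* gcd j n) ord≡e))) (trans n≡m*e (ℕP.*-comm m e)))))
    ... | no  ord≢e  | yes gcd≡m = ⊥-elim (ord≢e (ℕP.*-cancelʳ-≡ (ord j) e m ⦃ ℕ.>-nonZero 1≤m ⦄
          (trans (sym (trans (n≡ord*gcd j) (cong (ord j *_) gcd≡m))) (trans n≡m*e (ℕP.*-comm m e)))))

    -- The j < n with gcd j n ≡ m are the i m with i < e and gcd i e ≡ 1, where n = m e.
    count-ord≡φ : ∀ e → e ∣ n → count (λ j → ord j ≡ᵇ e) n ≡ φ e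
    count-ord≡φ e (divides m n≡m*e) = begin
      count (λ j → ord j ≡ᵇ e) n   ≡⟨ count-cong n (λ j _ → ord≡ᵇ e m n≡m*e 1≤e 1≤m j) ⟩
      count gcd≡m n                ≡⟨ cong (count gcd≡m) (trans n≡m*e (ℕP.*-comm m e)) ⟩
      count gcd≡m (e * m)          ≡⟨ count-multiples gcd≡m m 1≤m gcd≡m⇒m∣ e ⟩
      count (λ i → gcd≡m (i * m)) e ≡⟨ count-cong e (λ i _ → gcd[im,n]≡m i) ⟩
      φ e                           ∎
      where
      open ≡-Reasoning
      1≤e = ∣-pos 1≤n (divides m n≡m*e)
      1≤m = ∣-pos 1≤n (divides e (trans n≡m*e (ℕP.*-comm m e)))
      gcd≡m : ℕ → Bool
      gcd≡m j = gcd j n ≡ᵇ m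
      gcd≡m⇒m∣ : ∀ j → gcd≡m j ≡ true → m ∣ j
      gcd≡m⇒m∣ j holds with gcd j n ℕP.≟ m
      ... | yes gcd≡m = subst (_∣ j) gcd≡m (gcd[m,n]∣m j n)
      gcd-scaled : ∀ i → gcd (i * m) n ≡ m * gcd i e
      gcd-scaled i = trans (cong₂ gcd (ℕP.*-comm i m) n≡m*e) (sym (c*gcd[m,n]≡gcd[cm,cn] m i e))
      gcd[im,n]≡m : ∀ i → gcd≡m (i * m) ≡ (gcd i e ≡ᵇ 1)
      gcd[im,n]≡m i with gcd (i * m) n ℕP.≟ m | gcd i e ℕP.≟ 1
      ... | yes _ | yes _ = refl
      ... | no  _ | no  _ = refl
      ... | yes a | no  b = ⊥-elim (b (ℕP.*-cancelˡ-≡ (gcd i e) 1 m ⦃ ℕ.>-nonZero 1≤m ⦄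
                              (trans (sym (gcd-scaled i)) (trans a (sym (ℕP.*-identityʳ m))))))
      ... | no  a | yes b = ⊥-elim (a (trans (gcd-scaled i) (trans (cong (m *_) b) (ℕP.*-identityʳ m))))

    φ-+-∑φ : φ n + ∑ φ (properDivisors n) ≡ n
    φ-+-∑φ = trans (sym (∑-cong (n ∷ properDivisors n) (λ e∈ → count-ord≡φ _ (divisor e∈))))
                   (∑-count-fibres ord n (n ∷ properDivisors n) unique (λ j _ → ord∈divisors j))
      where
      divisor : ∀ {e} → e ∈ n ∷ properDivisors n → e ∣ n
      divisor (here refl) = ∣-refl
      divisor (there e∈)  = proj₂ (∈properDivisors⁻ n e∈)
      unique : Unique (n ∷ properDivisors n)
      unique = All.tabulate (λ e∈ n≡e → ℕP.<⇒≢ (proj₁ (∈properDivisors⁻ n e∈)) (sym n≡e)) ∷ properDivisors-unique n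

  φ-pos : ∀ n → 1 ≤ n → 1 ≤ φ n
  φ-pos (suc zero)    _ = ℕP.≤-refl
  φ-pos (suc (suc n)) _ = count-pos _ (suc (suc n)) 1 (s≤s (s≤s z≤n)) coprime
    where
    coprime : (gcd 1 (suc (suc n)) ≡ᵇ 1) ≡ true
    coprime with gcd 1 (suc (suc n)) ℕP.≟ 1
    ... | yes _     = refl
    ... | no  gcd≢1 = ⊥-elim (gcd≢1 (gcd-zeroˡ (suc (suc n))))

  -- Any a with a n + ∑ a (properDivisors n) ≡ n for 1 ≤ n < k agrees with φ there,
  -- so its sum over the proper divisors of k is k - φ k.
  ∑-properDivisors-< : ∀ k → 1 ≤ k → (a : ℕ → ℕ) →
    (∀ n → 1 ≤ n → n < k → a n + ∑ a (properDivisors n) ≡ n) → ∑ a (properDivisors k) < k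
  ∑-properDivisors-< k 1≤k a gauss = subst (_< k) (sym ∑a≡∑φ)
    (subst (∑ φ (properDivisors k) <_) (φ-+-∑φ k 1≤k) (ℕP.+-monoˡ-≤ (∑ φ (properDivisors k)) (φ-pos k 1≤k)))
    where
    a≡φ : ∀ B n → n ≤ B → 1 ≤ n → n < k → a n ≡ φ n
    a≡φ zero     n n≤B 1≤n n<k = ⊥-elim (ℕP.<⇒≱ (ℕP.≤-trans 1≤n n≤B) z≤n)
    a≡φ (suc B) n n≤B 1≤n n<k = ℕP.+-cancelʳ-≡ (∑ a (properDivisors n)) (a n) (φ n)
      (trans (gauss n 1≤n n<k) (trans (sym (φ-+-∑φ n 1≤n)) (cong (φ n +_) (sym (∑-cong (properDivisors n) below)))))
      where
      below : ∀ {e} → e ∈ properDivisors n → a e ≡ φ e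
      below {e} e∈ = a≡φ B e (ℕP.≤-pred (ℕP.≤-trans (proj₁ (∈properDivisors⁻ n e∈)) n≤B))
                       (∈properDivisors-pos n e∈) (ℕP.<-trans (proj₁ (∈properDivisors⁻ n e∈)) n<k)
    ∑a≡∑φ : ∑ a (properDivisors k) ≡ ∑ φ (properDivisors k)
    ∑a≡∑φ = ∑-cong (properDivisors k) (λ {e} e∈ →
      a≡φ e e ℕP.≤-refl (∈properDivisors-pos k e∈) (proj₁ (∈properDivisors⁻ k e∈)))


module Coprimality where

  open PolynomialRing
  open EulerOperator
  open Divisibility
  open Degree
  open import Data.Nat as ℕ using (zero; suc)
  import Data.Nat.Properties as ℕP
  open import Data.Nat.GCD as GCD using (gcd; gcd-GCD)
  open import Data.Integer as ℤ using (ℤ; 0ℤ; 1ℤ; _*_; -_)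
  import Data.Integer.Properties as ℤP
  open import Data.List using (List; _∷_; map; upTo; _++_)
  import Data.List.Properties as List
  open import Data.List.Membership.Propositional using (_∈_)
  import Data.List.Relation.Unary.All as All
  open import Data.List.Relation.Unary.Any using (here; there)
  open import Data.List.Relation.Unary.Unique.Propositional using (Unique; _∷_)
  open import Data.List.Relation.Binary.Sublist.Propositional using (_⊆_; []; _∷_; _∷ʳ_; ⊆-refl)
  open import Data.Product using (Σ; _×_; _,_)
  open import Relation.Nullary using (yes; no)
  open import Relation.Binary.PropositionalEquality using (_≡_; _≢_; refl; sym; subst)
  open import Tactic.RingSolver using (solve-∀)
  open import Relation.Binary.Reasoning.Setoid ≋-setoid

  -- Coprimality over ℚ, witnessed over ℤ: some nonzero constant is a combination u a + v b.
  record Coprime (a b : Poly) : Set where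
    constructor coprime
    field
      N   : ℤ
      N≢0 : N ≢ 0ℤ
      u v : Poly
      bezout : u *ₚ a +ₚ v *ₚ b ≋ const N

  coprime-sym : ∀ {a b} → Coprime a b → Coprime b a
  coprime-sym {a} {b} (coprime N N≢0 u v e) = coprime N N≢0 v u (≋-trans (+-comm (v *ₚ b) (u *ₚ a)) e)

  coprime-oneₚ : ∀ a → Coprime a oneₚ
  coprime-oneₚ a = coprime 1ℤ (λ ()) [] oneₚ (*-identityˡ oneₚ)

  coprime-* : ∀ {a b c} → Coprime a b → Coprime a c → Coprime a (b *ₚ c)
  coprime-* {a} {b} {c} (coprime N₁ N₁≢0 u₁ v₁ e₁) (coprime N₂ N₂≢0 u₂ v₂ e₂) =
    coprime (N₁ * N₂) (*-≢0 N₁≢0 N₂≢0) (u₁ *ₚ (u₂ *ₚ a +ₚ v₂ *ₚ c) +ₚ v₁ *ₚ b *ₚ u₂) (v₁ *ₚ v₂)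
      (≋-trans (expand u₁ u₂ v₁ v₂ a b c) (≋-trans (*-cong e₁ e₂) (≋-sym (const-* N₁ N₂))))
    where
    expand : ∀ u₁ u₂ v₁ v₂ a b c →
      (u₁ *ₚ (u₂ *ₚ a +ₚ v₂ *ₚ c) +ₚ v₁ *ₚ b *ₚ u₂) *ₚ a +ₚ v₁ *ₚ v₂ *ₚ (b *ₚ c) ≋
      (u₁ *ₚ a +ₚ v₁ *ₚ b) *ₚ (u₂ *ₚ a +ₚ v₂ *ₚ c)
    expand = solve-∀ ℤ[z]-almost

  coprime-factor : ∀ {a B c} P → P *ₚ c ≋ B → Coprime a B → Coprime a c
  coprime-factor {a} {B} {c} P Pc≋B (coprime N N≢0 u v e) =
    coprime N N≢0 u (v *ₚ P) (≋-trans (+-cong (≋-refl {u *ₚ a}) (≋-trans (*-assoc v P c) (*-congˡ v Pc≋B))) e)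

  coprime-∏ : ∀ (F : ℕ → Poly) a es → (∀ {e} → e ∈ es → Coprime a (F e)) → Coprime a (prodₚ (map F es))
  coprime-∏ F a []       cop = coprime-oneₚ a
  coprime-∏ F a (e ∷ es) cop = coprime-* (cop (here refl)) (coprime-∏ F a es (λ e∈ → cop (there e∈)))

  coprime-combination : ∀ {a Y A W P} u v → Coprime a Y → Y ≋ u *ₚ A +ₚ v *ₚ W → A ≋ P *ₚ a → Coprime a W
  coprime-combination {a} {Y} {A} {W} {P} u v (coprime N N≢0 u′ v′ e) Y≋ A≋ =
    coprime N N≢0 (u′ +ₚ v′ *ₚ u *ₚ P) (v′ *ₚ v) (begin
      (u′ +ₚ v′ *ₚ u *ₚ P) *ₚ a +ₚ v′ *ₚ v *ₚ W  ≈⟨ expand u′ v′ u v P a W ⟩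
      u′ *ₚ a +ₚ v′ *ₚ (u *ₚ (P *ₚ a) +ₚ v *ₚ W)  ≈⟨ +-cong ≋-refl (*-congˡ v′ (+-cong (*-congˡ u A≋) ≋-refl)) ⟨
      u′ *ₚ a +ₚ v′ *ₚ (u *ₚ A +ₚ v *ₚ W)         ≈⟨ +-cong ≋-refl (*-congˡ v′ Y≋) ⟨
      u′ *ₚ a +ₚ v′ *ₚ Y                          ≈⟨ e ⟩
      const N                                     ∎)
    where
    expand : ∀ u′ v′ u v P a W →
      (u′ +ₚ v′ *ₚ u *ₚ P) *ₚ a +ₚ v′ *ₚ v *ₚ W ≋ u′ *ₚ a +ₚ v′ *ₚ (u *ₚ (P *ₚ a) +ₚ v *ₚ W)
    expand = solve-∀ ℤ[z]-almost

  ∏-∣-const-* : ∀ (F : ℕ → Poly) A es → Unique es → (∀ {e} → e ∈ es → F e ∣≋ A) →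
    (∀ {e e′} → e ∈ es → e′ ∈ es → e ≢ e′ → Coprime (F e) (F e′)) →
    Σ ℤ (λ N → N ≢ 0ℤ × prodₚ (map F es) ∣≋ const N *ₚ A)
  ∏-∣-const-* F A []       _          _   _   = 1ℤ , (λ ()) , (A , ≋-refl)
  ∏-∣-const-* F A (e ∷ es) (e∉ ∷ uniq) F∣A cop
    with ∏-∣-const-* F A es uniq (λ e∈ → F∣A (there e∈)) (λ e∈ e′∈ e≢e′ → cop (there e∈) (there e′∈) e≢e′)
       | coprime-∏ F (F e) es (λ e′∈ → cop (here refl) (there e′∈) (λ e≡e′ → All.lookup e∉ e′∈ e≡e′))
       | F∣A (here refl)
  ... | N , N≢0 , (w , Qw≋NA) | coprime M M≢0 α β αF+βQ≋M | (v , Fv≋A) =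
    M * N , *-≢0 M≢0 N≢0 , (α *ₚ w +ₚ β *ₚ const N *ₚ v , (begin
      F e *ₚ Q *ₚ (α *ₚ w +ₚ β *ₚ const N *ₚ v)
        ≈⟨ expand (F e) Q α w β (const N) v ⟩
      α *ₚ F e *ₚ (Q *ₚ w) +ₚ β *ₚ Q *ₚ (const N *ₚ (F e *ₚ v))
        ≈⟨ +-cong (*-congˡ (α *ₚ F e) Qw≋NA) (*-congˡ (β *ₚ Q) (*-congˡ (const N) Fv≋A)) ⟩
      α *ₚ F e *ₚ (const N *ₚ A) +ₚ β *ₚ Q *ₚ (const N *ₚ A)
        ≈⟨ *-distribʳ (α *ₚ F e) (β *ₚ Q) (const N *ₚ A) ⟨
      (α *ₚ F e +ₚ β *ₚ Q) *ₚ (const N *ₚ A)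
        ≈⟨ *-congʳ (const N *ₚ A) αF+βQ≋M ⟩
      const M *ₚ (const N *ₚ A)
        ≈⟨ ≋-trans (*-congʳ A (const-* M N)) (*-assoc (const M) (const N) A) ⟨
      const (M * N) *ₚ A ∎))
    where
    Q = prodₚ (map F es)
    expand : ∀ Fe Q α w β KN v →
      Fe *ₚ Q *ₚ (α *ₚ w +ₚ β *ₚ KN *ₚ v) ≋ α *ₚ Fe *ₚ (Q *ₚ w) +ₚ β *ₚ Q *ₚ (KN *ₚ (Fe *ₚ v))
    expand = solve-∀ ℤ[z]-almost

  ∏-⊆-∣ : ∀ (F : ℕ → Poly) {es es′} → es ⊆ es′ → prodₚ (map F es) ∣≋ prodₚ (map F es′)
  ∏-⊆-∣ F []                = oneₚ , *-identityˡ oneₚ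
  ∏-⊆-∣ F {es} (y ∷ʳ es⊆) with ∏-⊆-∣ F es⊆
  ... | q , e = q *ₚ F y ,
    ≋-trans (≋-sym (*-assoc (prodₚ (map F es)) q (F y))) (≋-trans (*-congʳ (F y) e) (*-comm _ (F y)))
  ∏-⊆-∣ F {x ∷ es} (refl ∷ es⊆) with ∏-⊆-∣ F es⊆
  ... | q , e = q , ≋-trans (*-assoc (F x) (prodₚ (map F es)) q) (*-congˡ (F x) e)

  ∏-++ : ∀ (F : ℕ → Poly) es es′ → prodₚ (map F (es ++ es′)) ≋ prodₚ (map F es) *ₚ prodₚ (map F es′)
  ∏-++ F []       es′ = ≋-sym (*-identityˡ (prodₚ (map F es′)))
  ∏-++ F (x ∷ es) es′ =
    ≋-trans (*-congˡ (F x) (∏-++ F es es′)) (≋-sym (*-assoc (F x) (prodₚ (map F es)) (prodₚ (map F es′))))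

  upTo-⊆ : ∀ m n → m ≤ n → upTo m ⊆ upTo n
  upTo-⊆ zero    zero    _   = []
  upTo-⊆ m       (suc n) m≤n with m ℕP.≟ suc n
  ... | yes refl = ⊆-refl
  ... | no  m≢n  = subst (upTo m ⊆_) (List.upTo-∷ʳ n) (⊆-∷ʳ n (upTo-⊆ m n (ℕP.≤-pred (ℕP.≤∧≢⇒< m≤n m≢n))))
    where
    ⊆-∷ʳ : ∀ {xs ys : List ℕ} y → xs ⊆ ys → xs ⊆ ys ++ y ∷ []
    ⊆-∷ʳ y []          = y ∷ʳ []
    ⊆-∷ʳ y (z ∷ʳ xs⊆)  = z ∷ʳ ⊆-∷ʳ y xs⊆
    ⊆-∷ʳ y (x≡z ∷ xs⊆) = x≡z ∷ ⊆-∷ʳ y xs⊆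

  record Bézout (a b g : ℕ) : Set where
    constructor bézout
    field
      u v : Poly
      identity : u *ₚ (X^ a -ₚ oneₚ) +ₚ v *ₚ (X^ b -ₚ oneₚ) ≋ X^ g -ₚ oneₚ

  -- From g + y n ≡ x m: z^g - 1 = (z^(xm) - 1) - z^g (z^(yn) - 1).
  bézout-from : ∀ g m n x y → g ℕ.+ y ℕ.* n ≡ x ℕ.* m → Bézout m n g
  bézout-from g m n x y g+yn≡xm with X^-1∣X^*-1 m x | X^-1∣X^*-1 n y
  ... | q₁ , e₁ | q₂ , e₂ = bézout q₁ (negₚ (X^ g *ₚ q₂)) (begin
    q₁ *ₚ (X^ m -ₚ oneₚ) +ₚ negₚ (X^ g *ₚ q₂) *ₚ (X^ n -ₚ oneₚ)
      ≈⟨ rearrange q₁ (X^ m -ₚ oneₚ) (X^ g) q₂ (X^ n -ₚ oneₚ) ⟩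
    (X^ m -ₚ oneₚ) *ₚ q₁ -ₚ X^ g *ₚ ((X^ n -ₚ oneₚ) *ₚ q₂)
      ≈⟨ +-cong e₁ (neg-cong (*-congˡ (X^ g) e₂)) ⟩
    X^ (x ℕ.* m) -ₚ oneₚ -ₚ X^ g *ₚ (X^ (y ℕ.* n) -ₚ oneₚ)
      ≈⟨ +-cong (+-cong (≋-trans (X^-cong (sym g+yn≡xm)) (X^-+ g (y ℕ.* n))) ≋-refl) ≋-refl ⟩
    X^ g *ₚ X^ (y ℕ.* n) -ₚ oneₚ -ₚ X^ g *ₚ (X^ (y ℕ.* n) -ₚ oneₚ)
      ≈⟨ telescope (X^ g) (X^ (y ℕ.* n)) ⟩
    X^ g -ₚ oneₚ ∎)
    where
    X^-cong : ∀ {i j} → i ≡ j → X^ i ≋ X^ j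
    X^-cong refl = ≋-refl
    rearrange : ∀ Q₁ A G Q₂ B → Q₁ *ₚ A +ₚ negₚ (G *ₚ Q₂) *ₚ B ≋ A *ₚ Q₁ -ₚ G *ₚ (B *ₚ Q₂)
    rearrange = solve-∀ ℤ[z]-almost
    telescope : ∀ G Y → G *ₚ Y -ₚ oneₚ -ₚ G *ₚ (Y -ₚ oneₚ) ≋ G -ₚ oneₚ
    telescope = solve-∀ ℤ[z]-almost

  bézout-sym : ∀ {a b g} → Bézout a b g → Bézout b a g
  bézout-sym {a} {b} (bézout u v e) = bézout v u (≋-trans (+-comm (v *ₚ (X^ b -ₚ oneₚ)) (u *ₚ (X^ a -ₚ oneₚ))) e)

  bézout-gcd : ∀ a b → Bézout a b (gcd a b)
  bézout-gcd a b with GCD.Bézout.identity (gcd-GCD a b)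
  ... | GCD.Bézout.+- x y eq = bézout-from (gcd a b) a b x y eq
  ... | GCD.Bézout.-+ x y eq = bézout-sym (bézout-from (gcd a b) b a y x eq)

  θ⟨⟩-X^-1 : ∀ x → θ⟨ ℤ.+ x ⟩ (X^ x -ₚ oneₚ) ≋ const (ℤ.+ x)
  θ⟨⟩-X^-1 x = begin
    θ (X^ x -ₚ oneₚ) -ₚ Kx *ₚ (X^ x -ₚ oneₚ)        ≈⟨ +-cong (≋-trans (θ-sub (X^ x) oneₚ) (+-cong (θ-X^ x) ≋-refl)) ≋-refl ⟩
    (Kx *ₚ X^ x -ₚ θ oneₚ) -ₚ Kx *ₚ (X^ x -ₚ oneₚ)   ≈⟨ cancel Kx (X^ x) (θ oneₚ) ⟩
    Kx *ₚ oneₚ -ₚ θ oneₚ                           ≈⟨ +-cong (*-identityʳ Kx) (neg-cong (θ-const 1ℤ)) ⟩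
    Kx +ₚ []                                       ≈⟨ +-identityʳ Kx ⟩
    Kx                                             ∎
    where
    Kx = const (ℤ.+ x)
    cancel : ∀ K X E → (K *ₚ X -ₚ E) -ₚ K *ₚ (X -ₚ oneₚ) ≋ K *ₚ oneₚ -ₚ E
    cancel = solve-∀ ℤ[z]-almost

  X^-1-squarefree : ∀ x a Y R → 1 ≤ x → Y *ₚ R *ₚ a ≋ X^ x -ₚ oneₚ → Coprime a Y
  X^-1-squarefree x a Y R 1≤x YRa≋ = coprime (ℤ.+ x) x≢0 (θ (Y *ₚ R) -ₚ Kx *ₚ (Y *ₚ R)) (R *ₚ θ a) (begin
    (θ (Y *ₚ R) -ₚ Kx *ₚ (Y *ₚ R)) *ₚ a +ₚ R *ₚ θ a *ₚ Y
      ≈⟨ regroup (θ (Y *ₚ R)) Y R Kx a (θ a) ⟩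
    θ (Y *ₚ R) *ₚ a +ₚ Y *ₚ R *ₚ θ a -ₚ Kx *ₚ (Y *ₚ R *ₚ a)
      ≈⟨ +-cong (θ-* (Y *ₚ R) a) ≋-refl ⟨
    θ⟨ ℤ.+ x ⟩ (Y *ₚ R *ₚ a)
      ≈⟨ θ⟨⟩-cong (ℤ.+ x) YRa≋ ⟩
    θ⟨ ℤ.+ x ⟩ (X^ x -ₚ oneₚ)
      ≈⟨ θ⟨⟩-X^-1 x ⟩
    Kx ∎)
    where
    Kx = const (ℤ.+ x)
    x≢0 : ℤ.+ x ≢ 0ℤ
    x≢0 x≡0 = ℕP.<⇒≢ 1≤x (sym (ℤP.+-injective x≡0))
    regroup : ∀ T Y R K a Ta →
      (T -ₚ K *ₚ (Y *ₚ R)) *ₚ a +ₚ R *ₚ Ta *ₚ Y ≋ T *ₚ a +ₚ Y *ₚ R *ₚ Ta -ₚ K *ₚ (Y *ₚ R *ₚ a)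
    regroup = solve-∀ ℤ[z]-almost


module CyclotomicPolynomials where

  open PolynomialRing
  open EulerOperator
  open Divisibility
  open Degree
  open LongDivision
  open Totient
  open Coprimality
  open import Data.Nat as ℕ using (zero; suc; _<_; z≤n; s≤s; _∸_; pred)
  import Data.Nat.Properties as ℕP
  open import Data.Nat.Divisibility using (_∣_; _∣?_; divides; ∣-trans; ∣-antisym; ∣-refl; ∣⇒≤)
  open import Data.Integer as ℤ using (0ℤ)
  open import Data.Nat.GCD using (gcd; gcd[m,n]∣m; gcd[m,n]∣n; gcd[m,n]≡0⇒m≡0)
  open import Data.List using (_∷_; map; length; upTo; filter; _++_)
  import Data.List.Properties as List
  open import Data.List.Membership.Propositional using (_∈_)
  import Data.List.Relation.Unary.All as All
  open import Data.List.Relation.Unary.Any using (here; there)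
  import Data.List.Relation.Binary.Sublist.Propositional.Properties as Sublist
  open import Data.Product using (_,_; proj₁; proj₂)
  open import Data.Empty using (⊥-elim)
  open import Relation.Nullary using (yes; no)
  open import Relation.Binary.PropositionalEquality using (_≡_; _≢_; refl; sym; trans; cong; cong₂; subst)
  open import Relation.Binary.Reasoning.Setoid ≋-setoid

  -- Enough fuel: cycF f d unfolds fully once f ≥ d, since proper divisors are smaller.
  cycF-fuel : ∀ B d f f′ → 1 ≤ d → d ≤ B → d ≤ f → d ≤ f′ → cycF f d ≡ cycF f′ d
  cycF-fuel (suc B) (suc d) (suc f) (suc f′) _ d≤B d≤f d≤f′ =
    cong (λ P → divF (length (X^ (suc d) -ₚ oneₚ)) (X^ (suc d) -ₚ oneₚ) (prodₚ P))
         (List.map-cong-local (All.tabulate same))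
    where
    same : ∀ {e} → e ∈ properDivisors (suc d) → cycF f e ≡ cycF f′ e
    same {e} e∈ = cycF-fuel B e f f′ (∈properDivisors-pos (suc d) e∈) (below d≤B) (below d≤f) (below d≤f′)
      where
      below : ∀ {n} → suc d ≤ suc n → e ≤ n
      below le = ℕP.≤-pred (ℕP.≤-trans (proj₁ (∈properDivisors⁻ (suc d) e∈)) le)

  cycF≡Φ : ∀ d f → 1 ≤ d → d ≤ f → cycF f d ≡ Φ d
  cycF≡Φ d f 1≤d d≤f = cycF-fuel d d f d 1≤d ℕP.≤-refl d≤f ℕP.≤-refl

  deg : ℕ → ℕ
  deg n = pred (length (strip (Φ n)))

  ∏Φ : ℕ → Poly
  ∏Φ n = prodₚ (map Φ (properDivisors n))

  record CyclotomicFacts (n : ℕ) : Set where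
    field
      monic         : Monic (Φ n) (deg n)
      deg≥1         : 1 ≤ deg n
      factorisation : ∏Φ n *ₚ Φ n ≋ X^ n -ₚ oneₚ
      degree-sum    : deg n ℕ.+ ∑ deg (properDivisors n) ≡ n
  open CyclotomicFacts

  deg-monic : ∀ n s → Monic (Φ n) s → deg n ≡ s
  deg-monic n s Φ-monic = cong pred (proj₁ (monic-strip (Φ n) s Φ-monic))

  X^-1-monic : ∀ n → 1 ≤ n → Monic (X^ n -ₚ oneₚ) n
  X^-1-monic (suc n) _ =
    trans (coeff-sub (X^ (suc n)) oneₚ (suc n)) (cong (ℤ._+ ℤ.- 0ℤ) (coeff-X^-self (suc n))) ,
    (λ i n<i → trans (coeff-sub (X^ (suc n)) oneₚ i)
      (cong₂ (λ a b → a ℤ.+ ℤ.- b) (coeff-X^-other (suc n) i (λ e → ℕP.<⇒≢ n<i (sym e))) (one-vanish i n<i)))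
    where
    one-vanish : ∀ i → suc (suc n) ≤ i → coeff oneₚ i ≡ 0ℤ
    one-vanish (suc i) _ = refl

  ∏-monic : ∀ es → (∀ {e} → e ∈ es → Monic (Φ e) (deg e)) → Monic (prodₚ (map Φ es)) (∑ deg es)
  ∏-monic []       _       = refl , (λ { (suc i) _ → refl })
  ∏-monic (e ∷ es) Φ-monic =
    monic-* (Φ e) (prodₚ (map Φ es)) (Φ-monic (here refl)) (∏-monic es (λ e∈ → Φ-monic (there e∈)))

  -- z^g - 1 is the product of the Φ e over the divisors e of g, all of which divide x.
  X^-1∣∏Φ : ∀ g x → g < x → g ∣ x → CyclotomicFacts g → X^ g -ₚ oneₚ ∣≋ ∏Φ x
  X^-1∣∏Φ g x g<x g∣x Φg = ∣≋-resp divisors-of-g ≋-refl (∏-⊆-∣ Φ sub)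
    where
    sub = Sublist.filter⁺ (_∣? g) (_∣? x) (λ {a} {b} a≡b a∣g → subst (_∣ x) a≡b (∣-trans a∣g g∣x))
            (upTo-⊆ (suc g) x g<x)
    split : filter (_∣? g) (upTo (suc g)) ≡ properDivisors g ++ g ∷ []
    split = trans (cong (filter (_∣? g)) (sym (List.upTo-∷ʳ g)))
      (trans (List.filter-++ (_∣? g) (upTo g) (g ∷ [])) (cong (properDivisors g ++_) (List.filter-accept (_∣? g) ∣-refl)))
    divisors-of-g : prodₚ (map Φ (filter (_∣? g) (upTo (suc g)))) ≋ X^ g -ₚ oneₚ
    divisors-of-g = begin
      prodₚ (map Φ (filter (_∣? g) (upTo (suc g))))   ≡⟨ cong (λ es → prodₚ (map Φ es)) split ⟩
      prodₚ (map Φ (properDivisors g ++ g ∷ []))       ≈⟨ ∏-++ Φ (properDivisors g) (g ∷ []) ⟩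
      ∏Φ g *ₚ (Φ g *ₚ oneₚ)                          ≈⟨ *-congˡ (∏Φ g) (*-identityʳ (Φ g)) ⟩
      ∏Φ g *ₚ Φ g                                    ≈⟨ factorisation Φg ⟩
      X^ g -ₚ oneₚ                                   ∎

  module Step (k : ℕ) (1≤k : 1 ≤ k) (below : ∀ e → 1 ≤ e → e < k → CyclotomicFacts e) where

    -- With g = gcd x y < x: Φ x is coprime to its cofactor z^g - 1 in z^x - 1, and
    -- z^g - 1 is a combination of z^x - 1 and z^y - 1.
    Φ-coprime-X^-1 : ∀ x y → 1 ≤ x → x < k → ¬ x ∣ y → Coprime (Φ x) (X^ y -ₚ oneₚ)
    Φ-coprime-X^-1 x y 1≤x x<k x∤y with bézout-gcd x y
    ... | bézout u v identity =
      coprime-combination {P = ∏Φ x} u v Φx⊥X^g-1 (≋-sym identity) (≋-sym (factorisation Φx))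
      where
      g = gcd x y
      g∣x = gcd[m,n]∣m x y
      1≤g : 1 ≤ g
      1≤g = ℕP.n≢0⇒n>0 (λ g≡0 → ℕP.<⇒≢ 1≤x (sym (gcd[m,n]≡0⇒m≡0 g≡0)))
      g<x : g < x
      g<x = ℕP.≤∧≢⇒< (∣⇒≤ ⦃ ℕ.>-nonZero 1≤x ⦄ g∣x) (λ g≡x → x∤y (subst (_∣ y) g≡x (gcd[m,n]∣n x y)))
      Φx = below x 1≤x x<k
      X^g-1∣∏Φx = X^-1∣∏Φ g x g<x g∣x (below g 1≤g (ℕP.<-trans g<x x<k))
      Φx⊥X^g-1 : Coprime (Φ x) (X^ g -ₚ oneₚ)
      Φx⊥X^g-1 = X^-1-squarefree x (Φ x) (X^ g -ₚ oneₚ) (_∣≋_.quotient X^g-1∣∏Φx) 1≤x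
        (≋-trans (*-congʳ (Φ x) (_∣≋_.equality X^g-1∣∏Φx)) (factorisation Φx))

    module _ {e} (e∈ : e ∈ properDivisors k) where
      1≤e : 1 ≤ e
      1≤e = ∈properDivisors-pos k e∈
      e<k : e < k
      e<k = proj₁ (∈properDivisors⁻ k e∈)
      facts : CyclotomicFacts e
      facts = below e 1≤e e<k

    Φ-pairwise-coprime : ∀ {e e′} → e ∈ properDivisors k → e′ ∈ properDivisors k → e ≢ e′ →
                         Coprime (Φ e) (Φ e′)
    Φ-pairwise-coprime {e} {e′} e∈ e′∈ e≢e′ with e ∣? e′
    ... | no  e∤e′ = coprime-factor (∏Φ e′) (factorisation (facts e′∈))
                       (Φ-coprime-X^-1 e e′ (1≤e e∈) (e<k e∈) e∤e′)
    ... | yes e∣e′ = coprime-sym (coprime-factor (∏Φ e) (factorisation (facts e∈))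
                       (Φ-coprime-X^-1 e′ e (1≤e e′∈) (e<k e′∈) (λ e′∣e → e≢e′ (∣-antisym e∣e′ e′∣e))))

    Φ∣X^k-1 : ∀ {e} → e ∈ properDivisors k → Φ e ∣≋ X^ k -ₚ oneₚ
    Φ∣X^k-1 {e} e∈ with proj₂ (∈properDivisors⁻ k e∈)
    ... | divides t k≡te = ∣≋-trans (∏Φ e , ≋-trans (*-comm (Φ e) (∏Φ e)) (factorisation (facts e∈)))
                                    (subst (λ n → X^ e -ₚ oneₚ ∣≋ X^ n -ₚ oneₚ) (sym k≡te) (X^-1∣X^*-1 e t))

    ∏Φk-monic : Monic (∏Φ k) (∑ deg (properDivisors k))
    ∏Φk-monic = ∏-monic (properDivisors k) (λ e∈ → monic (facts e∈))

    Φk≡divF : ∀ k′ → k ≡ suc k′ → Φ k ≡ divF (length (X^ k -ₚ oneₚ)) (X^ k -ₚ oneₚ) (∏Φ k)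
    Φk≡divF k′ refl = cong (λ P → divF (length (X^ k -ₚ oneₚ)) (X^ k -ₚ oneₚ) (prodₚ P))
      (List.map-cong-local (All.tabulate (λ e∈ → cycF≡Φ _ k′ (1≤e e∈) (ℕP.≤-pred (e<k e∈)))))

    cyclotomicFacts : CyclotomicFacts k
    cyclotomicFacts
      with ∏-∣-const-* Φ (X^ k -ₚ oneₚ) (properDivisors k) (properDivisors-unique k) Φ∣X^k-1 Φ-pairwise-coprime
         | divF-correct (length (X^ k -ₚ oneₚ)) (∏Φ k) (∑ deg (properDivisors k)) ∏Φk-monic (X^ k -ₚ oneₚ)
             (ℕP.≤-trans (length-strip-≤ (X^ k -ₚ oneₚ) _ (vanishesFrom-length (X^ k -ₚ oneₚ))) (ℕP.m≤m+n _ _))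
    ... | N , N≢0 , (w , ∏Φw≋N[z^k-1]) | r , division , r-vanish = record
      { monic = Φk-monic ; deg≥1 = 1≤deg ; factorisation = Φk-factorisation ; degree-sum = sum }
      where
      s = ∑ deg (properDivisors k)
      division′ : X^ k -ₚ oneₚ ≋ ∏Φ k *ₚ Φ k +ₚ r
      division′ = subst (λ q → X^ k -ₚ oneₚ ≋ ∏Φ k *ₚ q +ₚ r)
        (sym (Φk≡divF (pred k) (sym (ℕP.suc-pred k ⦃ ℕ.>-nonZero 1≤k ⦄)))) division
      r≋0 = remainder-≋[] (∏Φ k) s (X^ k -ₚ oneₚ) w N (Φ k) r ∏Φk-monic ∏Φw≋N[z^k-1] N≢0 division′ r-vanish
      Φk-factorisation : ∏Φ k *ₚ Φ k ≋ X^ k -ₚ oneₚ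
      Φk-factorisation = ≋-sym (≋-trans division′ (≋-trans (+-cong ≋-refl r≋0) (+-identityʳ _)))
      quotient = monic-quotient (∏Φ k) s (X^ k -ₚ oneₚ) k (Φ k) ∏Φk-monic (X^-1-monic k 1≤k)
                   (≋-sym Φk-factorisation)
      deg≡ : deg k ≡ k ∸ s
      deg≡ = deg-monic k (k ∸ s) (proj₁ quotient)
      Φk-monic : Monic (Φ k) (deg k)
      Φk-monic = subst (Monic (Φ k)) (sym deg≡) (proj₁ quotient)
      1≤deg : 1 ≤ deg k
      1≤deg = subst (1 ≤_) (sym deg≡) (ℕP.m<n⇒0<n∸m
        (∑-properDivisors-< k 1≤k deg (λ n 1≤n n<k → degree-sum (below n 1≤n n<k))))
      sum : deg k ℕ.+ s ≡ k
      sum = trans (cong (ℕ._+ s) deg≡) (trans (ℕP.+-comm (k ∸ s) s) (proj₂ quotient))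

  cyclotomic-facts : ∀ k → 1 ≤ k → CyclotomicFacts k
  cyclotomic-facts k = bounded k k ℕP.≤-refl
    where
    bounded : ∀ B k → k ≤ B → 1 ≤ k → CyclotomicFacts k
    bounded zero    k k≤0   1≤k = ⊥-elim (ℕP.<⇒≱ 1≤k k≤0)
    bounded (suc B) k k≤1+B 1≤k =
      Step.cyclotomicFacts k 1≤k (λ e 1≤e e<k → bounded B e (ℕP.≤-pred (ℕP.≤-trans e<k k≤1+B)) 1≤e)


open PolynomialRing
open Divisibility
open Degree
open MultiplicityBound
open CyclotomicPolynomials
import Data.Nat as ℕ
import Data.Nat.Properties as ℕP
open import Data.List using (length)
open import Data.Product using (_,_)

lemma11 : (d : ℕ) → 2 ≤ d → (f : Poly) → ¬ (f ≈ₚ []) → (k : ℕ) → 1 ≤ k →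
            ∃[ c ] ((m : ℕ) → (σ< c) (Φ k) (f ∘ₚ X^ (d ^ m)))
lemma11 d 2≤d f f≉0 (ℕ.suc N) 1≤k = length f , λ m n Φk^n∣ →
  ^∣[z^]⇒<length (deg≥1 facts) Φk-degree Φk∣z^k-1 (1≤d^ m) f (λ f≋0 → f≉0 (at f≋0)) n (∣ₚ⇒∣≋ Φk^n∣)
  where
  open CyclotomicFacts
  k = ℕ.suc N
  facts = cyclotomic-facts k 1≤k
  Φk-degree : HasDegree (Φ k) (deg k)
  Φk-degree = monic⇒hasDegree (Φ k) (monic facts)
  Φk∣z^k-1 : Φ k ∣≋ X^ k -ₚ oneₚ
  Φk∣z^k-1 = ∏Φ k , ≋-trans (*-comm (Φ k) (∏Φ k)) (factorisation facts)
  1≤d^_ : ∀ m → 1 ≤ d ^ m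
  1≤d^ m = ℕP.m^n>0 d ⦃ ℕ.>-nonZero (ℕP.≤-trans (ℕ.s≤s ℕ.z≤n) 2≤d) ⦄ m
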